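{- For every $n\ge 1$, $|\mathrm{Sort}_n(\mathfrak{s}_{\underline{12}3})|=C_{n-1}+\sum_{i=0}^{n-2}2^{n-2-i}C_i$, where $C_i$ is the $i$-th Catalan number.
   Context: A pattern is a permutation $\sigma$ in which some blocks of consecutive entries may be underlined; a sequence contains it if it has a subsequence order-isomorphic to $\sigma$ whose entries corresponding to a common underlined block are adjacent in the sequence. Pattern-avoiding stack map $\mathfrak{s}_\sigma$: process input $\tau_1,\dots,\tau_n$ in order; when $\tau_i$ is next, while the stack is nonempty and the sequence formed by placing $\tau_i$ on top of the stack, read top to bottom, contains $\sigma$ (underlined entries adjacent in the stack), pop the top entry to the output; then push $\tau_i$; at the end pop all remaining entries top to bottom to the output. West's stack-sorting map $s$ pushes each input entry after popping all smaller stack entries to the output, emptying the stack at the end. $\mathrm{Sort}_n(\mathfrak{s}_\sigma)=\{\tau\in\mathfrak S_n: s(\mathfrak{s}_\sigma(\tau))=12\cdots n\}$. $C_i=\frac{1}{i+1}\binom{2i}{i}$. -}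

module Defs where

open import Data.Nat using (ℕ; zero; suc; _+_; _*_; _∸_; _^_; _/_; _≡ᵇ_; _<ᵇ_)
open import Data.Nat.Combinatorics using (_C_)
open import Data.Bool using (Bool; true; false; _∧_; _∨_; if_then_else_)
open import Data.Product using (Σ; _×_; _,_)
open import Data.Bool using (T)
open import Relation.Binary.PropositionalEquality using (_≡_)
open import Data.List using (List; []; _∷_; _++_; [_]; length; map; upTo)
open import Data.Bool.ListAction using (all; any)

occ : ℕ → List ℕ → ℕ
occ k []       = 0
occ k (x ∷ xs) = if k ≡ᵇ x then suc (occ k xs) else occ k xs

ascending : ℕ → List ℕ
ascending n = map suc (upTo n)

isPerm : ℕ → List ℕ → Bool
isPerm n τ = (length τ ≡ᵇ n) ∧ all (λ k → occ k τ ≡ᵇ 1) (ascending n)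

-- Containment of the pattern  (underline 12) 3  in a sequence w:
-- positions j < j+1 < k with w_j < w_{j+1} < w_k (w_j, w_{j+1} adjacent).
-- anyGreater b xs : some entry of xs exceeds b
anyGreater : ℕ → List ℕ → Bool
anyGreater b xs = any (λ c → b <ᵇ c) xs

contains-12-3 : List ℕ → Bool
contains-12-3 []            = false
contains-12-3 (a ∷ [])      = false
contains-12-3 (a ∷ b ∷ ws)  =
  ((a <ᵇ b) ∧ anyGreater b ws) ∨ contains-12-3 (b ∷ ws)

-- Stacks are lists with the head being the top of the stack.
popWhile : (List ℕ → Bool) → ℕ → List ℕ → List ℕ → List ℕ × List ℕ
popWhile cont x []       out = [] , out
popWhile cont x (y ∷ st) out =
  if cont (x ∷ y ∷ st) then popWhile cont x st (out ++ [ y ]) else (y ∷ st , out)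

stackMapGo : (List ℕ → Bool) → List ℕ → List ℕ → List ℕ → List ℕ
stackMapGo cont []       st out = out ++ st
stackMapGo cont (x ∷ xs) st out with popWhile cont x st out
... | st' , out' = stackMapGo cont xs (x ∷ st') out'

patternStackMap : (List ℕ → Bool) → List ℕ → List ℕ
patternStackMap cont τ = stackMapGo cont τ [] []

s-12-3 : List ℕ → List ℕ
s-12-3 = patternStackMap contains-12-3

westPop : ℕ → List ℕ → List ℕ → List ℕ × List ℕ
westPop x []       out = [] , out
westPop x (y ∷ st) out =
  if y <ᵇ x then westPop x st (out ++ [ y ]) else (y ∷ st , out)

westGo : List ℕ → List ℕ → List ℕ → List ℕ
westGo []       st out = out ++ st
westGo (x ∷ xs) st out with westPop x st out
... | st' , out' = westGo xs (x ∷ st') out'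

westSort : List ℕ → List ℕ
westSort τ = westGo τ [] []

catalan : ℕ → ℕ
catalan i = ((2 * i) C i) / suc i

sumBelow : ℕ → (ℕ → ℕ) → ℕ
sumBelow zero    f = 0
sumBelow (suc m) f = sumBelow m f + f m

Sort-12-3 : ℕ → Set
Sort-12-3 n = Σ (List ℕ) (λ τ → T (isPerm n τ) × westSort (s-12-3 τ) ≡ ascending n)

formula : ℕ → ℕ
formula n = catalan (n ∸ 1) + sumBelow (n ∸ 1) (λ i → 2 ^ (n ∸ 2 ∸ i) * catalan i)

{-# OPTIONS --safe #-}
-- Write τ ∈ 𝔖_{n+1} as L (n+1) R. While n+1 sits in the stack of s_{12-3}, an entry
-- above it is popped exactly when the incoming entry is smaller (together with n+1
-- below they form the pattern), and n+1 itself is never popped, so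
-- s_{12-3}(τ) = out(L) s₁₂(R) (n+1) stack(L), where out(L) and stack(L) are the output
-- and the final stack of s_{12-3} on L. West's map splits this word at n+1, so it
-- sorts it only if everything before n+1 is below everything after it. Since every
-- entry of out(L) exceeds some entry of stack(L), this forces out(L) to be empty,
-- R to be a permutation of 1..i with s₁₂(R) decreasing, and stack(L) to be
-- West-sortable. Splitting such an R at its entry 1 gives the Catalan recursion,
-- realised by a bijection with binary trees, which are counted by ballot numbers.
-- Splitting such an L at its maximum forces everything after the maximum to be
-- increasing, which leaves 2^(k-1) left parts of size k ≥ 1. Summing C_i times the
-- number of left parts of size n - i gives the formula.
module Submission where

open import Defs
open import Data.Bool using (Bool; true; false; _∧_; _∨_; if_then_else_; T)
open import Data.Bool.Properties using (∨-zeroʳ; ∨-identityʳ; ∧-identityʳ; ∧-zeroʳ; T-∧; T-irrelevant)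
open import Data.Bool.ListAction using (all)
open import Data.Empty using (⊥; ⊥-elim)
open import Data.Fin using (Fin)
import Data.Fin.Properties as Fin
open import Data.List using (List; []; _∷_; _++_; [_]; length; map; reverse; _ʳ++_; upTo)
import Data.List.Properties as List
open import Data.List.Membership.Propositional using (_∈_; _∉_)
open import Data.List.Membership.Propositional.Properties using (∈-∃++; ∈-insert)
open import Data.List.Relation.Unary.All using (All; []; _∷_)
import Data.List.Relation.Unary.All as All
import Data.List.Relation.Unary.All.Properties as All
open import Data.List.Relation.Unary.Any using (Any; here; there)
import Data.List.Relation.Unary.Any as Any
import Data.List.Relation.Unary.Any.Properties as Any
open import Data.List.Relation.Binary.Permutation.Propositional
  using (_↭_; ↭-refl; ↭-sym; ↭-trans; ↭-reflexive; prep; module PermutationReasoning)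
import Data.List.Relation.Binary.Permutation.Propositional as ↭
import Data.List.Relation.Binary.Permutation.Propositional.Properties as ↭
open import Data.Nat using (ℕ; zero; suc; _+_; _*_; _∸_; _^_; _/_; _≤_; _<_; z≤n; s≤s; _<ᵇ_; _≡ᵇ_)
open import Data.Nat.Properties
open import Data.Nat.Combinatorics using (_C_; nCk+nC[k+1]≡[n+1]C[k+1]; nC1≡n; nCk≡nC[n∸k])
open import Data.Nat.DivMod using (m*n/n≡m)
open import Data.Nat.Induction using (<-rec)
open import Data.Nat.Solver using (module +-*-Solver)
open import Data.Product using (Σ; _×_; _,_; proj₁; proj₂; ∃; ∃₂)
open import Data.Product.Function.NonDependent.Propositional using (_×-↔_)
open import Data.Sum using (_⊎_; inj₁; inj₂)
open import Data.Sum.Function.Propositional using (_⊎-↔_)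
open import Function using (_∘_)
open import Function.Bundles using (Equivalence; Inverse; _↔_; mk↔ₛ′)
open import Function.Properties.Inverse using (↔-refl; ↔-sym; ↔-trans)
open import Relation.Binary.PropositionalEquality hiding ([_])
open import Axiom.UniquenessOfIdentityProofs using (module Decidable⇒UIP)

open +-*-Solver using (solve; _:+_; _:*_; _:=_; con)

-- Stack machines

-- A rule sees the incoming entry, the top of the stack and the rest of the stack.
-- pop returns the remaining stack and the popped entries; run returns the final
-- stack and the output. Stacks are listed top first.
PopRule : Set
PopRule = ℕ → ℕ → List ℕ → Bool

pop : PopRule → ℕ → List ℕ → List ℕ × List ℕ
pop pops x []       = [] , []
pop pops x (y ∷ st) =
  if pops x y st then (proj₁ (pop pops x st) , y ∷ proj₂ (pop pops x st)) else (y ∷ st , [])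

run : PopRule → List ℕ → List ℕ → List ℕ × List ℕ
run pops []       st = st , []
run pops (x ∷ xs) st =
  proj₁ (run pops xs (x ∷ proj₁ (pop pops x st))) ,
  proj₂ (pop pops x st) ++ proj₂ (run pops xs (x ∷ proj₁ (pop pops x st)))

stackSort : PopRule → List ℕ → List ℕ
stackSort pops xs = proj₂ (run pops xs []) ++ proj₁ (run pops xs [])

patternRule : (List ℕ → Bool) → PopRule
patternRule contains x y st = contains (x ∷ y ∷ st)

localRule : (ℕ → ℕ → Bool) → PopRule
localRule pops x y _ = pops x y

_>ᵇ_ : ℕ → ℕ → Bool
x >ᵇ y = y <ᵇ x

-- For σ = 21 and σ = 12 the pattern is formed by the incoming entry and the top.
ruleσ rule₂₁ rule₁₂ : PopRule
ruleσ  = patternRule contains-12-3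
rule₂₁ = localRule _>ᵇ_
rule₁₂ = localRule _<ᵇ_

stackσ outputσ : List ℕ → List ℕ
stackσ  xs = proj₁ (run ruleσ xs [])
outputσ xs = proj₂ (run ruleσ xs [])

sσ s₂₁ s₁₂ : List ℕ → List ℕ
sσ  = stackSort ruleσ
s₂₁ = stackSort rule₂₁
s₁₂ = stackSort rule₁₂

pop-yes : ∀ pops x y st → pops x y st ≡ true → pop pops x (y ∷ st) ≡ (proj₁ (pop pops x st) , y ∷ proj₂ (pop pops x st))
pop-yes pops x y st yes rewrite yes = refl

pop-no : ∀ pops x y st → pops x y st ≡ false → pop pops x (y ∷ st) ≡ (y ∷ st , [])
pop-no pops x y st no rewrite no = refl

pop-split : ∀ pops x st → proj₂ (pop pops x st) ++ proj₁ (pop pops x st) ≡ st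
pop-split pops x []       = refl
pop-split pops x (y ∷ st) with pops x y st
... | true  = cong (y ∷_) (pop-split pops x st)
... | false = refl

run-++ : ∀ pops xs ys st → let r = run pops xs st ; r′ = run pops ys (proj₁ r) in
  run pops (xs ++ ys) st ≡ (proj₁ r′ , proj₂ r ++ proj₂ r′)
run-++ pops []       ys st = refl
run-++ pops (x ∷ xs) ys st rewrite run-++ pops xs ys (x ∷ proj₁ (pop pops x st)) =
  cong (proj₁ (run pops ys (proj₁ (run pops xs (x ∷ proj₁ (pop pops x st))))) ,_)
       (sym (List.++-assoc (proj₂ (pop pops x st)) _ _))

run-↭ : ∀ pops xs st → proj₂ (run pops xs st) ++ proj₁ (run pops xs st) ↭ xs ++ st
run-↭ pops []       st = ↭-refl
run-↭ pops (x ∷ xs) st = begin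
  (popped ++ out) ++ final   ≡⟨ List.++-assoc popped out final ⟩
  popped ++ out ++ final     ↭⟨ ↭.++⁺ˡ popped (run-↭ pops xs (x ∷ kept)) ⟩
  popped ++ xs ++ x ∷ kept   ≡⟨ List.++-assoc popped xs (x ∷ kept) ⟨
  (popped ++ xs) ++ x ∷ kept ↭⟨ ↭.shift x (popped ++ xs) kept ⟩
  x ∷ (popped ++ xs) ++ kept ≡⟨ cong (x ∷_) (List.++-assoc popped xs kept) ⟩
  x ∷ popped ++ xs ++ kept   ↭⟨ prep x (↭.shifts popped xs) ⟩
  x ∷ xs ++ popped ++ kept   ≡⟨ cong (λ st′ → x ∷ xs ++ st′) (pop-split pops x st) ⟩
  x ∷ xs ++ st               ∎
  where
  open PermutationReasoning
  popped = proj₂ (pop pops x st)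
  kept   = proj₁ (pop pops x st)
  out    = proj₂ (run pops xs (x ∷ kept))
  final  = proj₁ (run pops xs (x ∷ kept))

run-silent : ∀ pops xs st → proj₂ (run pops xs st) ≡ [] → proj₁ (run pops xs st) ≡ xs ʳ++ st
run-silent pops []       st _      = refl
run-silent pops (x ∷ xs) st silent =
  trans (run-silent pops xs (x ∷ kept) (List.++-conicalʳ popped _ silent))
        (cong (λ st′ → xs ʳ++ (x ∷ st′)) kept≡st)
  where
  popped = proj₂ (pop pops x st)
  kept   = proj₁ (pop pops x st)
  kept≡st : kept ≡ st
  kept≡st = trans (cong (_++ kept) (sym (List.++-conicalˡ popped _ silent))) (pop-split pops x st)

run-All : ∀ {P : ℕ → Set} pops xs st → All P (xs ++ st) →
  All P (proj₂ (run pops xs st)) × All P (proj₁ (run pops xs st))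
run-All pops xs st a = All.++⁻ _ (↭.All-resp-↭ (↭-sym (run-↭ pops xs st)) a)

stackSort-↭ : ∀ pops xs → stackSort pops xs ↭ xs
stackSort-↭ pops xs = ↭-trans (run-↭ pops xs []) (↭-reflexive (List.++-identityʳ xs))

stackSort-≡⇒↭ : ∀ pops {xs ys} → stackSort pops xs ≡ ys → xs ↭ ys
stackSort-≡⇒↭ pops {xs} sorted = ↭-trans (↭-sym (stackSort-↭ pops xs)) (↭-reflexive sorted)

popWhile≡pop : ∀ contains x st out →
  popWhile contains x st out ≡ (proj₁ (pop (patternRule contains) x st) , out ++ proj₂ (pop (patternRule contains) x st))
popWhile≡pop contains x []       out = cong ([] ,_) (sym (List.++-identityʳ out))
popWhile≡pop contains x (y ∷ st) out with contains (x ∷ y ∷ st)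
... | true  = trans (popWhile≡pop contains x st (out ++ [ y ]))
                    (cong (proj₁ (pop (patternRule contains) x st) ,_) (List.++-assoc out [ y ] _))
... | false = cong (y ∷ st ,_) (sym (List.++-identityʳ out))

stackMapGo≡run : ∀ contains xs st out → let r = run (patternRule contains) xs st in
  stackMapGo contains xs st out ≡ out ++ proj₂ r ++ proj₁ r
stackMapGo≡run contains []       st out = refl
stackMapGo≡run contains (x ∷ xs) st out rewrite popWhile≡pop contains x st out =
  trans (stackMapGo≡run contains xs (x ∷ proj₁ p) (out ++ proj₂ p))
        (trans (List.++-assoc out _ _) (cong (out ++_) (sym (List.++-assoc (proj₂ p) _ _))))
  where p = pop (patternRule contains) x st

s-12-3≡sσ : ∀ τ → s-12-3 τ ≡ sσ τ
s-12-3≡sσ τ = stackMapGo≡run contains-12-3 τ [] []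

westPop≡pop : ∀ x st out → westPop x st out ≡ (proj₁ (pop rule₂₁ x st) , out ++ proj₂ (pop rule₂₁ x st))
westPop≡pop x []       out = cong ([] ,_) (sym (List.++-identityʳ out))
westPop≡pop x (y ∷ st) out with y <ᵇ x
... | true  = trans (westPop≡pop x st (out ++ [ y ]))
                    (cong (proj₁ (pop rule₂₁ x st) ,_) (List.++-assoc out [ y ] _))
... | false = cong (y ∷ st ,_) (sym (List.++-identityʳ out))

westGo≡run : ∀ xs st out → let r = run rule₂₁ xs st in westGo xs st out ≡ out ++ proj₂ r ++ proj₁ r
westGo≡run []       st out = refl
westGo≡run (x ∷ xs) st out rewrite westPop≡pop x st out =
  trans (westGo≡run xs (x ∷ proj₁ p) (out ++ proj₂ p))
        (trans (List.++-assoc out _ _) (cong (out ++_) (sym (List.++-assoc (proj₂ p) _ _))))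
  where p = pop rule₂₁ x st

westSort≡s₂₁ : ∀ τ → westSort τ ≡ s₂₁ τ
westSort≡s₂₁ τ = westGo≡run τ [] []

-- Shifting values

shift : ℕ → List ℕ → List ℕ
shift s = map (s +_)

shift² : ℕ → List ℕ × List ℕ → List ℕ × List ℕ
shift² s (st , out) = shift s st , shift s out

ShiftInvariant : PopRule → Set
ShiftInvariant pops = ∀ s x y st → pops (s + x) (s + y) (shift s st) ≡ pops x y st

pop-shift : ∀ {pops} → ShiftInvariant pops → ∀ s x st → pop pops (s + x) (shift s st) ≡ shift² s (pop pops x st)
pop-shift {pops} inv s x []       = refl
pop-shift {pops} inv s x (y ∷ st) rewrite inv s x y st with pops x y st
... | true  = cong (λ p → proj₁ p , (s + y) ∷ proj₂ p) (pop-shift inv s x st)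
... | false = refl

run-shift : ∀ {pops} → ShiftInvariant pops → ∀ s xs st → run pops (shift s xs) (shift s st) ≡ shift² s (run pops xs st)
run-shift {pops} inv s []       st = refl
run-shift {pops} inv s (x ∷ xs) st
  rewrite pop-shift inv s x st | run-shift inv s xs (x ∷ proj₁ (pop pops x st)) =
  cong (shift s (proj₁ (run pops xs (x ∷ proj₁ (pop pops x st)))) ,_)
       (sym (List.map-++ (s +_) (proj₂ (pop pops x st)) _))

stackSort-shift : ∀ {pops} → ShiftInvariant pops → ∀ s xs → stackSort pops (shift s xs) ≡ shift s (stackSort pops xs)
stackSort-shift {pops} inv s xs rewrite run-shift inv s xs [] =
  sym (List.map-++ (s +_) (proj₂ (run pops xs [])) _)

shift-injective : ∀ s {A B} → shift s A ≡ shift s B → A ≡ B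
shift-injective s = List.map-injective (+-cancelˡ-≡ s _ _)

shift-∸ : ∀ s {L} → All (s ≤_) L → shift s (map (_∸ s) L) ≡ L
shift-∸ s []            = refl
shift-∸ s (s≤x ∷ s≤xs) = cong₂ _∷_ (m+[n∸m]≡n s≤x) (shift-∸ s s≤xs)

<ᵇ-shift : ∀ s a b → ((s + a) <ᵇ (s + b)) ≡ (a <ᵇ b)
<ᵇ-shift zero    a b = refl
<ᵇ-shift (suc s) a b = <ᵇ-shift s a b

anyGreater-shift : ∀ s b ws → anyGreater (s + b) (shift s ws) ≡ anyGreater b ws
anyGreater-shift s b []       = refl
anyGreater-shift s b (c ∷ ws) = cong₂ _∨_ (<ᵇ-shift s b c) (anyGreater-shift s b ws)

contains-12-3-shift : ∀ s ws → contains-12-3 (shift s ws) ≡ contains-12-3 ws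
contains-12-3-shift s []           = refl
contains-12-3-shift s (a ∷ [])     = refl
contains-12-3-shift s (a ∷ b ∷ ws) =
  cong₂ _∨_ (cong₂ _∧_ (<ᵇ-shift s a b) (anyGreater-shift s b ws)) (contains-12-3-shift s (b ∷ ws))

runσ-shift : ∀ s xs → run ruleσ (shift s xs) [] ≡ shift² s (run ruleσ xs [])
runσ-shift s xs = run-shift (λ s x y st → contains-12-3-shift s (x ∷ y ∷ st)) s xs []

s₂₁-shift : ∀ s xs → s₂₁ (shift s xs) ≡ shift s (s₂₁ xs)
s₂₁-shift = stackSort-shift (λ s x y _ → <ᵇ-shift s y x)

s₁₂-shift : ∀ s xs → s₁₂ (shift s xs) ≡ shift s (s₁₂ xs)
s₁₂-shift = stackSort-shift (λ s x y _ → <ᵇ-shift s x y)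

-- Intervals and permutations

interval : ℕ → ℕ → List ℕ
interval a zero    = []
interval a (suc n) = suc a ∷ interval (suc a) n

interval-++ : ∀ a i j → interval a (i + j) ≡ interval a i ++ interval (a + i) j
interval-++ a zero    j = cong (λ b → interval b j) (sym (+-identityʳ a))
interval-++ a (suc i) j = cong (suc a ∷_)
  (trans (interval-++ (suc a) i j) (cong (λ b → interval (suc a) i ++ interval b j) (sym (+-suc a i))))

interval-∷ʳ : ∀ a n → interval a (suc n) ≡ interval a n ++ [ suc (a + n) ]
interval-∷ʳ a n = trans (cong (interval a) (+-comm 1 n)) (interval-++ a n 1)

length-interval : ∀ a n → length (interval a n) ≡ n
length-interval a zero    = refl
length-interval a (suc n) = cong suc (length-interval (suc a) n)

shift-interval : ∀ s n → shift s (interval 0 n) ≡ interval s n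
shift-interval s n = trans (shift-interval′ 0 n) (cong (λ b → interval b n) (+-identityʳ s))
  where
  shift-interval′ : ∀ a n → shift s (interval a n) ≡ interval (s + a) n
  shift-interval′ a zero    = refl
  shift-interval′ a (suc n) = cong₂ _∷_ (+-suc s a) (trans (shift-interval′ (suc a) n) (cong (λ b → interval b n) (+-suc s a)))

shift-reverse-interval : ∀ s n → shift s (reverse (interval 0 n)) ≡ reverse (interval s n)
shift-reverse-interval s n = trans (List.reverse-map (s +_) (interval 0 n)) (cong reverse (shift-interval s n))

reverse-interval-split : ∀ b a → reverse (interval 0 (suc (b + a))) ≡ reverse (interval (suc b) a) ++ reverse (interval 1 b) ++ [ 1 ]
reverse-interval-split b a = begin
  reverse (1 ∷ interval 1 (b + a))
    ≡⟨ cong (reverse ∘ (1 ∷_)) (interval-++ 1 b a) ⟩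
  reverse ((1 ∷ interval 1 b) ++ interval (suc b) a)
    ≡⟨ List.reverse-++ (1 ∷ interval 1 b) (interval (suc b) a) ⟩
  reverse (interval (suc b) a) ++ reverse (1 ∷ interval 1 b)
    ≡⟨ cong (reverse (interval (suc b) a) ++_) (List.unfold-reverse 1 (interval 1 b)) ⟩
  reverse (interval (suc b) a) ++ reverse (interval 1 b) ++ [ 1 ]
    ∎
  where open ≡-Reasoning

ascending≡interval : ∀ n → ascending n ≡ interval 0 n
ascending≡interval zero    = refl
ascending≡interval (suc n) = begin
  map suc (upTo (suc n))       ≡⟨ cong (map suc) (List.upTo-∷ʳ n) ⟨
  map suc (upTo n ++ [ n ])    ≡⟨ List.map-++ suc (upTo n) [ n ] ⟩
  ascending n ++ [ suc n ]     ≡⟨ cong (_++ [ suc n ]) (ascending≡interval n) ⟩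
  interval 0 n ++ [ suc n ]    ≡⟨ interval-∷ʳ 0 n ⟨
  interval 0 (suc n)           ∎
  where open ≡-Reasoning

++≡interval : ∀ a n X {Y} → X ++ Y ≡ interval a n →
  length X ≤ n × X ≡ interval a (length X) × Y ≡ interval (a + length X) (n ∸ length X)
++≡interval a n       []      eq = z≤n , refl , trans eq (cong (λ b → interval b n) (sym (+-identityʳ a)))
++≡interval a (suc n) (x ∷ X) eq with List.∷-injective eq
... | refl , eq′ with ++≡interval (suc a) n X eq′
... | i≤n , X≡ , Y≡ =
  s≤s i≤n , cong (suc a ∷_) X≡ , trans Y≡ (cong (λ b → interval b (n ∸ length X)) (sym (+-suc a (length X))))

++≡reverse-interval : ∀ a n X Y → X ++ Y ≡ reverse (interval a n) →
  length Y ≤ n × Y ≡ reverse (interval a (length Y)) × X ≡ reverse (interval (a + length Y) (n ∸ length Y))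
++≡reverse-interval a n X Y eq
  with ++≡interval a n (reverse Y) (trans (sym (List.reverse-++ X Y)) (trans (cong reverse eq) (List.reverse-involutive _)))
... | b≤n , Y≡ , X≡ rewrite List.length-reverse Y = b≤n , reverse-flip Y≡ , reverse-flip X≡
  where
  reverse-flip : ∀ {A B : List ℕ} → reverse A ≡ B → A ≡ reverse B
  reverse-flip {A} eq = trans (sym (List.reverse-involutive A)) (cong reverse eq)

∈-interval : ∀ {x} a n → x ∈ interval a n → a < x × x ≤ a + n
∈-interval a (suc n) (here refl) = ≤-refl , subst (suc a ≤_) (sym (+-suc a n)) (s≤s (m≤m+n a n))
∈-interval a (suc n) (there x∈) with ∈-interval (suc a) n x∈
... | a<x , x≤ = <-trans (n<1+n a) a<x , ≤-trans x≤ (≤-reflexive (sym (+-suc a n)))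

↭-interval-above : ∀ {L} a n → L ↭ interval a n → All (a <_) L
↭-interval-above a n p = All.tabulate (λ x∈ → proj₁ (∈-interval a n (↭.∈-resp-↭ p x∈)))

↭-interval-below : ∀ {L} a n → L ↭ interval a n → All (_≤ a + n) L
↭-interval-below a n p = All.tabulate (λ x∈ → proj₂ (∈-interval a n (↭.∈-resp-↭ p x∈)))

occ-↭ : ∀ k {xs ys} → xs ↭ ys → occ k xs ≡ occ k ys
occ-↭ k ↭.refl = refl
occ-↭ k (↭.prep x p) with k ≡ᵇ x
... | true  = cong suc (occ-↭ k p)
... | false = occ-↭ k p
occ-↭ k (↭.swap x y p) with k ≡ᵇ x | k ≡ᵇ y
... | true  | true  = cong (suc ∘ suc) (occ-↭ k p)
... | true  | false = cong suc (occ-↭ k p)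
... | false | true  = cong suc (occ-↭ k p)
... | false | false = occ-↭ k p
occ-↭ k (↭.trans p q) = trans (occ-↭ k p) (occ-↭ k q)

occ-∉ : ∀ k xs → k ∉ xs → occ k xs ≡ 0
occ-∉ k []       _   = refl
occ-∉ k (x ∷ xs) k∉ with k ≡ᵇ x in k≡ᵇx
... | true  = ⊥-elim (k∉ (here (≡ᵇ⇒≡ k x (subst T (sym k≡ᵇx) _))))
... | false = occ-∉ k xs (k∉ ∘ there)

occ-interval : ∀ k a n → a < k → k ≤ a + n → occ k (interval a n) ≡ 1
occ-interval k a zero    a<k k≤a = ⊥-elim (<-irrefl refl (<-≤-trans a<k (subst (k ≤_) (+-identityʳ a) k≤a)))
occ-interval k a (suc n) a<k k≤ with k ≡ᵇ suc a in k≡ᵇ1+a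
... | true  = cong suc (occ-∉ k (interval (suc a) n)
                (λ k∈ → <-irrefl (sym (≡ᵇ⇒≡ k (suc a) (subst T (sym k≡ᵇ1+a) _))) (proj₁ (∈-interval (suc a) n k∈))))
... | false = occ-interval k (suc a) n (≤∧≢⇒< a<k (λ 1+a≡k → subst T k≡ᵇ1+a (≡⇒≡ᵇ k (suc a) (sym 1+a≡k))))
                (subst (k ≤_) (+-suc a n) k≤)

All⇒T-all : ∀ (p : ℕ → Bool) {xs} → All (T ∘ p) xs → T (all p xs)
All⇒T-all p []         = _
All⇒T-all p (px ∷ pxs) = Equivalence.from T-∧ (px , All⇒T-all p pxs)

↭-interval⇒isPerm : ∀ n τ → τ ↭ interval 0 n → T (isPerm n τ)
↭-interval⇒isPerm n τ p =
  Equivalence.from T-∧ (length-ok , All⇒T-all _ (subst (All _) (sym (ascending≡interval n)) (All.tabulate once)))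
  where
  length-ok : T (length τ ≡ᵇ n)
  length-ok = ≡⇒≡ᵇ (length τ) n (trans (↭.↭-length p) (length-interval 0 n))
  once : ∀ {k} → k ∈ interval 0 n → T (occ k τ ≡ᵇ 1)
  once {k} k∈ with ∈-interval 0 n k∈
  ... | 0<k , k≤n = ≡⇒≡ᵇ (occ k τ) 1 (trans (occ-↭ k p) (occ-interval k 0 n 0<k k≤n))

↭-split : ∀ {τ e} (A B : List ℕ) → τ ↭ A ++ e ∷ B → ∃₂ λ X Y → τ ≡ X ++ e ∷ Y × X ++ Y ↭ A ++ B
↭-split A B p with ∈-∃++ (↭.∈-resp-↭ (↭-sym p) (∈-insert A))
... | X , Y , refl = X , Y , refl , ↭.drop-mid X A p

split-at-max : ∀ n {τ} → τ ↭ interval 0 (suc n) →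
  ∃₂ λ X Y → τ ≡ X ++ suc n ∷ Y × All (_< suc n) X × All (_< suc n) Y
split-at-max n p with ↭-split (interval 0 n) [] (↭-trans p (↭-reflexive (interval-∷ʳ 0 n)))
... | X , Y , τ≡ , p′ =
  X , Y , τ≡ , All.++⁻ X (All.map s≤s (↭-interval-below 0 n (↭-trans p′ (↭-reflexive (List.++-identityʳ _)))))

split-at-1 : ∀ m {τ} → τ ↭ interval 0 (suc m) →
  ∃₂ λ X Y → τ ≡ X ++ 1 ∷ Y × All (1 <_) X × All (1 <_) Y
split-at-1 m p with ↭-split [] (interval 1 m) p
... | X , Y , τ≡ , p′ = X , Y , τ≡ , All.++⁻ X (↭-interval-above 1 m p′)

∷-split-injective : ∀ {e : ℕ} (X : List ℕ) {Y} (X′ : List ℕ) {Y′} → e ∉ X → e ∉ X′ →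
  X ++ e ∷ Y ≡ X′ ++ e ∷ Y′ → X ≡ X′ × Y ≡ Y′
∷-split-injective []      []       _   _    eq = refl , List.∷-injectiveʳ eq
∷-split-injective []      (_ ∷ _)  _   e∉X′ eq = ⊥-elim (e∉X′ (here (List.∷-injectiveˡ eq)))
∷-split-injective (_ ∷ _) []       e∉X _    eq = ⊥-elim (e∉X (here (sym (List.∷-injectiveˡ eq))))
∷-split-injective (x ∷ X) (_ ∷ X′) e∉X e∉X′ eq with List.∷-injective eq
... | refl , eq′ with ∷-split-injective X X′ (e∉X ∘ there) (e∉X′ ∘ there) eq′
... | refl , Y≡Y′ = refl , Y≡Y′

<-∉ : ∀ {e X} → All (_< e) X → e ∉ X
<-∉ (x<e ∷ _)    (here refl) = <-irrefl refl x<e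
<-∉ (_ ∷ X<e) (there e∈X) = <-∉ X<e e∈X

>-∉ : ∀ {e X} → All (e <_) X → e ∉ X
>-∉ (e<x ∷ _)    (here refl) = <-irrefl refl e<x
>-∉ (_ ∷ X>e) (there e∈X) = >-∉ X>e e∈X

List≡-irrelevant : {xs ys : List ℕ} (p q : xs ≡ ys) → p ≡ q
List≡-irrelevant = Decidable⇒UIP.≡-irrelevant (List.≡-dec _≟_)

-- Local pop rules

<ᵇ-true : ∀ {m n} → m < n → (m <ᵇ n) ≡ true
<ᵇ-true {zero}  {suc n} _         = refl
<ᵇ-true {suc m} {suc n} (s≤s m<n) = <ᵇ-true m<n

<ᵇ-false : ∀ {m n} → n ≤ m → (m <ᵇ n) ≡ false
<ᵇ-false {m}     {zero}  z≤n       = refl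
<ᵇ-false {suc m} {suc n} (s≤s n≤m) = <ᵇ-false n≤m

<ᵇ-true⁻¹ : ∀ {m n} → (m <ᵇ n) ≡ true → m < n
<ᵇ-true⁻¹ {m} {n} eq = <ᵇ⇒< m n (subst T (sym eq) _)

module _ (pops : ℕ → ℕ → Bool) where

  private
    rule = localRule pops

  pop-local-blocked : ∀ e W x Z → pops x e ≡ false →
    pop rule x (Z ++ e ∷ W) ≡ (proj₁ (pop rule x Z) ++ e ∷ W , proj₂ (pop rule x Z))
  pop-local-blocked e W x []      blocked rewrite blocked = refl
  pop-local-blocked e W x (y ∷ Z) blocked with pops x y
  ... | true  = cong (λ p → proj₁ p , y ∷ proj₂ p) (pop-local-blocked e W x Z blocked)
  ... | false = refl

  run-local-blocked : ∀ e W xs Z → All (λ x → pops x e ≡ false) xs →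
    run rule xs (Z ++ e ∷ W) ≡ (proj₁ (run rule xs Z) ++ e ∷ W , proj₂ (run rule xs Z))
  run-local-blocked e W []       Z []                  = refl
  run-local-blocked e W (x ∷ xs) Z (blocked ∷ blocked′)
    rewrite pop-local-blocked e W x Z blocked
          | run-local-blocked e W xs (x ∷ proj₁ (pop rule x Z)) blocked′ = refl

  pop-local-all : ∀ e st → All (λ z → pops e z ≡ true) st → pop rule e st ≡ ([] , st)
  pop-local-all e []       []             = refl
  pop-local-all e (y ∷ st) (pops-y ∷ pops-st) rewrite pops-y | pop-local-all e st pops-st = refl

  pop-local-none : ∀ x st → All (λ y → pops x y ≡ false) st → pop rule x st ≡ (st , [])
  pop-local-none x []       []          = refl
  pop-local-none x (y ∷ st) (keep ∷ _) rewrite keep = refl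

  -- On arrival e empties the stack, and afterwards it is never popped.
  stackSort-local-split : ∀ e X Y → All (λ z → pops e z ≡ true) X → All (λ y → pops y e ≡ false) Y →
    stackSort rule (X ++ e ∷ Y) ≡ stackSort rule X ++ stackSort rule Y ++ [ e ]
  stackSort-local-split e X Y popsX blockedY = begin
    proj₂ (run rule (X ++ e ∷ Y) []) ++ proj₁ (run rule (X ++ e ∷ Y) [])
      ≡⟨ cong (λ r → proj₂ r ++ proj₁ r) (run-++ rule X (e ∷ Y) []) ⟩
    (outX ++ proj₂ (pop rule e stX) ++ proj₂ (run rule Y (e ∷ proj₁ (pop rule e stX))))
      ++ proj₁ (run rule Y (e ∷ proj₁ (pop rule e stX)))
      ≡⟨ cong (λ p → (outX ++ proj₂ p ++ proj₂ (run rule Y (e ∷ proj₁ p))) ++ proj₁ (run rule Y (e ∷ proj₁ p)))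
              (pop-local-all e stX (proj₂ (run-All rule X [] (All.++⁺ popsX [])))) ⟩
    (outX ++ stX ++ proj₂ (run rule Y ([] ++ e ∷ []))) ++ proj₁ (run rule Y ([] ++ e ∷ []))
      ≡⟨ cong (λ r → (outX ++ stX ++ proj₂ r) ++ proj₁ r) (run-local-blocked e [] Y [] blockedY) ⟩
    (outX ++ stX ++ outY) ++ stY ++ [ e ]
      ≡⟨ List.++-assoc outX (stX ++ outY) _ ⟩
    outX ++ (stX ++ outY) ++ stY ++ [ e ]
      ≡⟨ cong (outX ++_) (List.++-assoc stX outY _) ⟩
    outX ++ stX ++ outY ++ stY ++ [ e ]
      ≡⟨ List.++-assoc outX stX _ ⟨
    (outX ++ stX) ++ outY ++ stY ++ [ e ]
      ≡⟨ cong ((outX ++ stX) ++_) (List.++-assoc outY stY [ e ]) ⟨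
    (outX ++ stX) ++ (outY ++ stY) ++ [ e ]
      ∎
    where
    open ≡-Reasoning
    outX = proj₂ (run rule X [])
    stX  = proj₁ (run rule X [])
    outY = proj₂ (run rule Y [])
    stY  = proj₁ (run rule Y [])

s₁₂-around-min : ∀ {e X Y} → All (e <_) X → All (e <_) Y → s₁₂ (X ++ e ∷ Y) ≡ s₁₂ X ++ s₁₂ Y ++ [ e ]
s₁₂-around-min {e} {X} {Y} X>e Y>e =
  stackSort-local-split _<ᵇ_ e X Y (All.map <ᵇ-true X>e) (All.map (<ᵇ-false ∘ <⇒≤) Y>e)

s₂₁-around-max : ∀ {e X Y} → All (_< e) X → All (_< e) Y → s₂₁ (X ++ e ∷ Y) ≡ s₂₁ X ++ s₂₁ Y ++ [ e ]
s₂₁-around-max {e} {X} {Y} X<e Y<e =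
  stackSort-local-split _>ᵇ_ e X Y (All.map <ᵇ-true X<e) (All.map (<ᵇ-false ∘ <⇒≤) Y<e)

s₁₂-All : ∀ {P : ℕ → Set} {R} → All P R → All P (s₁₂ R)
s₁₂-All {R = R} = ↭.All-resp-↭ (↭-sym (stackSort-↭ rule₁₂ R))

s₂₁-reverse-interval : ∀ a n → s₂₁ (reverse (interval a n)) ≡ interval a n
s₂₁-reverse-interval a zero    = refl
s₂₁-reverse-interval a (suc n) = begin
  s₂₁ (reverse (interval a (suc n)))               ≡⟨ cong (s₂₁ ∘ reverse) (interval-∷ʳ a n) ⟩
  s₂₁ (reverse (interval a n ++ [ top ]))          ≡⟨ cong s₂₁ (List.reverse-++ (interval a n) [ top ]) ⟩
  s₂₁ ([] ++ top ∷ reverse (interval a n))         ≡⟨ s₂₁-around-max [] (All.map s≤s below) ⟩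
  s₂₁ (reverse (interval a n)) ++ [ top ]          ≡⟨ cong (_++ [ top ]) (s₂₁-reverse-interval a n) ⟩
  interval a n ++ [ top ]                          ≡⟨ interval-∷ʳ a n ⟨
  interval a (suc n)                               ∎
  where
  open ≡-Reasoning
  top = suc (a + n)
  below = ↭-interval-below a n (↭.↭-reverse (interval a n))

run₁₂-interval : ∀ a n st → All (_≤ a) st → run rule₁₂ (interval a n) st ≡ (interval a n ʳ++ st , [])
run₁₂-interval a zero    st _    = refl
run₁₂-interval a (suc n) st st≤a
  rewrite pop-local-none _<ᵇ_ (suc a) st (All.map (<ᵇ-false ∘ m≤n⇒m≤1+n) st≤a) =
  run₁₂-interval (suc a) n (suc a ∷ st) (≤-refl ∷ All.map m≤n⇒m≤1+n st≤a)

s₂₁-∷ʳ-min : ∀ m W → All (m <_) W →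
  s₂₁ (W ++ [ m ]) ≡ (proj₂ (run rule₂₁ W []) ++ []) ++ m ∷ proj₁ (run rule₂₁ W [])
s₂₁-∷ʳ-min m W W>m
  rewrite run-++ rule₂₁ W [ m ] []
        | pop-local-none _>ᵇ_ m (proj₁ (run rule₂₁ W []))
            (All.map (<ᵇ-false ∘ <⇒≤) (proj₂ (run-All rule₂₁ W [] (All.++⁺ W>m [])))) = refl

-- Everything West's map outputs before m is larger than m, so the output must be
-- empty and W stays on the stack in reverse order.
s₂₁-sorted-∷ʳ-min : ∀ m W {Z} → All (m <_) W → s₂₁ (W ++ [ m ]) ≡ m ∷ Z → W ≡ reverse Z
s₂₁-sorted-∷ʳ-min m W W>m sorted
  with proj₂ (run rule₂₁ W []) in silent
     | trans (sym (s₂₁-∷ʳ-min m W W>m)) sorted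
     | proj₁ (run-All rule₂₁ W [] (All.++⁺ W>m []))
... | []    | eq | _         =
  trans (sym (List.reverse-involutive W))
        (cong reverse (trans (sym (run-silent rule₂₁ W [] silent)) (List.∷-injectiveʳ eq)))
... | o ∷ _ | eq | m<o ∷ _ = ⊥-elim (<-irrefl (sym (List.∷-injectiveˡ eq)) m<o)

s₂₁∘s₁₂-sorted⇒decreasing : ∀ i R → s₂₁ (s₁₂ R) ≡ interval 0 i → s₁₂ R ≡ reverse (interval 0 i)
s₂₁∘s₁₂-sorted⇒decreasing zero    R sorted = ↭.↭-empty-inv (stackSort-≡⇒↭ rule₂₁ sorted)
s₂₁∘s₁₂-sorted⇒decreasing (suc i) R sorted
  with split-at-1 i (↭-trans (↭-sym (stackSort-↭ rule₁₂ R)) (stackSort-≡⇒↭ rule₂₁ sorted))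
... | X , Y , refl , X>1 , Y>1 = begin
  s₁₂ (X ++ 1 ∷ Y)                 ≡⟨ s₁₂-around-min X>1 Y>1 ⟩
  s₁₂ X ++ s₁₂ Y ++ [ 1 ]          ≡⟨ List.++-assoc (s₁₂ X) (s₁₂ Y) [ 1 ] ⟨
  (s₁₂ X ++ s₁₂ Y) ++ [ 1 ]        ≡⟨ cong (_++ [ 1 ]) (s₂₁-sorted-∷ʳ-min 1 _ W>1 sorted′) ⟩
  reverse (interval 1 i) ++ [ 1 ]  ≡⟨ List.unfold-reverse 1 (interval 1 i) ⟨
  reverse (interval 0 (suc i))     ∎
  where
  open ≡-Reasoning
  W>1 : All (1 <_) (s₁₂ X ++ s₁₂ Y)
  W>1 = All.++⁺ (s₁₂-All X>1) (s₁₂-All Y>1)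
  sorted′ : s₂₁ ((s₁₂ X ++ s₁₂ Y) ++ [ 1 ]) ≡ 1 ∷ interval 1 i
  sorted′ = trans (cong s₂₁ (trans (List.++-assoc (s₁₂ X) (s₁₂ Y) [ 1 ]) (sym (s₁₂-around-min X>1 Y>1)))) sorted

s₂₁-sorted-around-max : ∀ n {P Q} → All (_< suc n) P → All (_< suc n) Q → s₂₁ (P ++ suc n ∷ Q) ≡ interval 0 (suc n) →
  length (s₂₁ P) ≤ n × s₂₁ P ≡ interval 0 (length (s₂₁ P)) × s₂₁ Q ≡ interval (length (s₂₁ P)) (n ∸ length (s₂₁ P))
s₂₁-sorted-around-max n {P} {Q} P<N Q<N sorted = ++≡interval 0 n (s₂₁ P) (List.∷ʳ-injectiveˡ _ _ (begin
  (s₂₁ P ++ s₂₁ Q) ++ [ suc n ]  ≡⟨ List.++-assoc (s₂₁ P) (s₂₁ Q) [ suc n ] ⟩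
  s₂₁ P ++ s₂₁ Q ++ [ suc n ]    ≡⟨ s₂₁-around-max P<N Q<N ⟨
  s₂₁ (P ++ suc n ∷ Q)           ≡⟨ sorted ⟩
  interval 0 (suc n)             ≡⟨ interval-∷ʳ 0 n ⟩
  interval 0 n ++ [ suc n ]      ∎))
  where open ≡-Reasoning

s₂₁-sorted-separated : ∀ {O S Q i k} → s₂₁ (O ++ S) ≡ interval 0 i → s₂₁ Q ≡ interval i k →
  All (λ o → All (o <_) Q) O
s₂₁-sorted-separated {O} {i = i} {k} sortedOS sortedQ =
  All.map (λ o≤i → All.map (≤-<-trans o≤i) (↭-interval-above i k (stackSort-≡⇒↭ rule₂₁ sortedQ)))
          (proj₁ (All.++⁻ O (↭-interval-below 0 i (stackSort-≡⇒↭ rule₂₁ sortedOS))))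

-- The machine s_{12-3}

contains-12-3-tail : ∀ a w → contains-12-3 (a ∷ w) ≡ false → contains-12-3 w ≡ false
contains-12-3-tail a []       _       = refl
contains-12-3-tail a (b ∷ ws) avoids with contains-12-3 (b ∷ ws)
... | false = refl
... | true  = subst (λ c → c ≡ false) (∨-zeroʳ _) avoids

pushσ-avoids : ∀ x st → contains-12-3 (x ∷ proj₁ (pop ruleσ x st)) ≡ false
pushσ-avoids x []       = refl
pushσ-avoids x (y ∷ st) with contains-12-3 (x ∷ y ∷ st) in eq
... | true  = pushσ-avoids x st
... | false = eq

runσ-avoids : ∀ xs st → contains-12-3 st ≡ false → contains-12-3 (proj₁ (run ruleσ xs st)) ≡ false
runσ-avoids []       st avoids = avoids
runσ-avoids (x ∷ xs) st _      = runσ-avoids xs (x ∷ proj₁ (pop ruleσ x st)) (pushσ-avoids x st)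

-- On a stack avoiding the pattern, an occurrence in x ∷ y ∷ st must start with x < y.
poppedσ-above : ∀ x st → contains-12-3 st ≡ false → All (x <_) (proj₂ (pop ruleσ x st))
poppedσ-above x []       _      = []
poppedσ-above x (y ∷ st) avoids with contains-12-3 (x ∷ y ∷ st) in occurs
... | true  = <ᵇ-true⁻¹ (head-pair (x <ᵇ y) occurs avoids) ∷ poppedσ-above x st (contains-12-3-tail y st avoids)
  where
  head-pair : ∀ p {q r} → ((p ∧ q) ∨ r) ≡ true → r ≡ false → p ≡ true
  head-pair true  _      _     = refl
  head-pair false occurs refl = occurs
... | false = []

runσ-keeps-≤ : ∀ xs st → contains-12-3 st ≡ false → ∀ z → Any (_≤ z) st → Any (_≤ z) (proj₁ (run ruleσ xs st))
runσ-keeps-≤ []       st _      z below = below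
runσ-keeps-≤ (x ∷ xs) st avoids z below = runσ-keeps-≤ xs (x ∷ kept) (pushσ-avoids x st) z pushed
  where
  kept   = proj₁ (pop ruleσ x st)
  popped = proj₂ (pop ruleσ x st)
  pushed : Any (_≤ z) (x ∷ kept)
  pushed with Any.++⁻ popped (subst (Any (_≤ z)) (sym (pop-split ruleσ x st)) below)
  ... | inj₁ in-popped = here (All-Any-≤ (poppedσ-above x st avoids) in-popped)
    where
    All-Any-≤ : ∀ {os} → All (x <_) os → Any (_≤ z) os → x ≤ z
    All-Any-≤ (x<o ∷ _)   (here o≤z)  = ≤-trans (<⇒≤ x<o) o≤z
    All-Any-≤ (_ ∷ x<os) (there o≤z) = All-Any-≤ x<os o≤z
  ... | inj₂ in-kept   = there in-kept

-- Each popped entry exceeds the entry pushed in its place, and that entry (or a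
-- smaller one) stays on the stack for good.
outputσ-above-stack : ∀ xs st → contains-12-3 st ≡ false →
  All (λ o → Any (_< o) (proj₁ (run ruleσ xs st))) (proj₂ (run ruleσ xs st))
outputσ-above-stack []       st _      = []
outputσ-above-stack (x ∷ xs) st avoids =
  All.++⁺ (All.map above-x (poppedσ-above x st avoids)) (outputσ-above-stack xs (x ∷ kept) (pushσ-avoids x st))
  where
  kept = proj₁ (pop ruleσ x st)
  above-x : ∀ {o} → x < o → Any (_< o) (proj₁ (run ruleσ xs (x ∷ kept)))
  above-x x<o = Any.map (λ w≤x → ≤-<-trans w≤x x<o) (runσ-keeps-≤ xs (x ∷ kept) (pushσ-avoids x st) x (here ≤-refl))

outputσ-below-stack⇒[] : ∀ xs → All (λ o → All (o <_) (stackσ xs)) (outputσ xs) → outputσ xs ≡ []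
outputσ-below-stack⇒[] xs below with outputσ xs | outputσ-above-stack xs [] refl
... | []    | _                = refl
... | o ∷ _ | o-above ∷ _ with below
...   | o-below ∷ _ = ⊥-elim (All-Any-< o-below o-above)
  where
  All-Any-< : ∀ {o ys} → All (o <_) ys → Any (_< o) ys → ⊥
  All-Any-< (o<y ∷ _)   (here y<o)  = <-asym o<y y<o
  All-Any-< (_ ∷ o<ys) (there y<o) = All-Any-< o<ys y<o

anyGreater-none : ∀ N B → All (_< N) B → anyGreater N B ≡ false
anyGreater-none N []       []            = refl
anyGreater-none N (c ∷ B) (c<N ∷ B<N) rewrite <ᵇ-false {N} {c} (<⇒≤ c<N) = anyGreater-none N B B<N

anyGreater-∈ : ∀ y N Z B → y < N → anyGreater y (Z ++ N ∷ B) ≡ true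
anyGreater-∈ y N []      B y<N rewrite <ᵇ-true y<N = refl
anyGreater-∈ y N (c ∷ Z) B y<N with y <ᵇ c
... | true  = refl
... | false = anyGreater-∈ y N Z B y<N

contains-12-3-max∷ : ∀ N st → All (_< N) st → contains-12-3 st ≡ false → contains-12-3 (N ∷ st) ≡ false
contains-12-3-max∷ N []       _             _      = refl
contains-12-3-max∷ N (y ∷ st) (y<N ∷ _) avoids rewrite <ᵇ-false {N} {y} (<⇒≤ y<N) = avoids

popσ-max : ∀ N st → All (_< N) st → contains-12-3 st ≡ false → pop ruleσ N st ≡ (st , [])
popσ-max N []       _    _      = refl
popσ-max N (y ∷ st) st<N avoids = pop-no ruleσ N y st (contains-12-3-max∷ N (y ∷ st) st<N avoids)

ruleσ-above-max : ∀ x y Z N B → y < N → contains-12-3 (y ∷ Z ++ N ∷ B) ≡ false →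
  ruleσ x y (Z ++ N ∷ B) ≡ (x <ᵇ y)
ruleσ-above-max x y Z N B y<N avoids rewrite anyGreater-∈ y N Z B y<N | avoids =
  trans (∨-identityʳ _) (∧-identityʳ (x <ᵇ y))

-- Above a larger entry N, the pattern occurs exactly when the incoming entry is
-- smaller than the top, so the part of the stack above N behaves like s₁₂.
popσ-above-max : ∀ N B x Z → All (_< N) Z → All (_< N) B → contains-12-3 (Z ++ N ∷ B) ≡ false →
  pop ruleσ x (Z ++ N ∷ B) ≡ (proj₁ (pop rule₁₂ x Z) ++ N ∷ B , proj₂ (pop rule₁₂ x Z))
popσ-above-max N B x [] [] B<N avoids = pop-no ruleσ x N B keeps-N
  where
  keeps-N : contains-12-3 (x ∷ N ∷ B) ≡ false
  keeps-N rewrite anyGreater-none N B B<N | avoids = trans (∨-identityʳ _) (∧-zeroʳ (x <ᵇ N))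
popσ-above-max N B x (y ∷ Z) (y<N ∷ Z<N) B<N avoids = by-comparison (x <ᵇ y) refl
  where
  decides = ruleσ-above-max x y Z N B y<N avoids
  by-comparison : ∀ b → (x <ᵇ y) ≡ b →
    pop ruleσ x (y ∷ Z ++ N ∷ B) ≡ (proj₁ (pop rule₁₂ x (y ∷ Z)) ++ N ∷ B , proj₂ (pop rule₁₂ x (y ∷ Z)))
  by-comparison true x<ᵇy = begin
    pop ruleσ x (y ∷ Z ++ N ∷ B)
      ≡⟨ pop-yes ruleσ x y _ (trans decides x<ᵇy) ⟩
    (proj₁ (pop ruleσ x (Z ++ N ∷ B)) , y ∷ proj₂ (pop ruleσ x (Z ++ N ∷ B)))
      ≡⟨ cong (λ p → proj₁ p , y ∷ proj₂ p) (popσ-above-max N B x Z Z<N B<N (contains-12-3-tail y (Z ++ N ∷ B) avoids)) ⟩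
    (proj₁ (pop rule₁₂ x Z) ++ N ∷ B , y ∷ proj₂ (pop rule₁₂ x Z))
      ≡⟨ cong (λ p → proj₁ p ++ N ∷ B , proj₂ p) (pop-yes rule₁₂ x y Z x<ᵇy) ⟨
    (proj₁ (pop rule₁₂ x (y ∷ Z)) ++ N ∷ B , proj₂ (pop rule₁₂ x (y ∷ Z)))
      ∎
    where open ≡-Reasoning
  by-comparison false x≮ᵇy =
    trans (pop-no ruleσ x y _ (trans decides x≮ᵇy))
          (sym (cong (λ p → proj₁ p ++ N ∷ B , proj₂ p) (pop-no rule₁₂ x y Z x≮ᵇy)))

runσ-above-max : ∀ N B R Z → All (_< N) R → All (_< N) Z → All (_< N) B → contains-12-3 (Z ++ N ∷ B) ≡ false →
  run ruleσ R (Z ++ N ∷ B) ≡ (proj₁ (run rule₁₂ R Z) ++ N ∷ B , proj₂ (run rule₁₂ R Z))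
runσ-above-max N B []      Z _            _   _   _      = refl
runσ-above-max N B (x ∷ R) Z (x<N ∷ R<N) Z<N B<N avoids
  rewrite popσ-above-max N B x Z Z<N B<N avoids =
  cong (λ r → proj₁ r , proj₂ (pop rule₁₂ x Z) ++ proj₂ r)
       (runσ-above-max N B R (x ∷ kept) R<N (x<N ∷ kept<N) B<N avoids′)
  where
  kept = proj₁ (pop rule₁₂ x Z)
  kept<N : All (_< N) kept
  kept<N = proj₂ (All.++⁻ _ (subst (All (_< N)) (sym (pop-split rule₁₂ x Z)) Z<N))
  avoids′ : contains-12-3 (x ∷ kept ++ N ∷ B) ≡ false
  avoids′ = subst (λ st → contains-12-3 (x ∷ st) ≡ false)
                  (cong proj₁ (popσ-above-max N B x Z Z<N B<N avoids)) (pushσ-avoids x (Z ++ N ∷ B))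

runσ-around-max : ∀ L N R → All (_< N) L → All (_< N) R →
  run ruleσ (L ++ N ∷ R) [] ≡ (proj₁ (run rule₁₂ R []) ++ N ∷ stackσ L , outputσ L ++ proj₂ (run rule₁₂ R []))
runσ-around-max L N R L<N R<N =
  trans (run-++ ruleσ L (N ∷ R) []) (cong (λ r → proj₁ r , outputσ L ++ proj₂ r) run-from-N)
  where
  stack<N : All (_< N) (stackσ L)
  stack<N = proj₂ (run-All ruleσ L [] (All.++⁺ L<N []))
  avoids : contains-12-3 (stackσ L) ≡ false
  avoids = runσ-avoids L [] refl
  run-from-N : run ruleσ (N ∷ R) (stackσ L) ≡ (proj₁ (run rule₁₂ R []) ++ N ∷ stackσ L , proj₂ (run rule₁₂ R []))
  run-from-N rewrite popσ-max N (stackσ L) stack<N avoids =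
    runσ-above-max N (stackσ L) R [] R<N [] stack<N (contains-12-3-max∷ N (stackσ L) stack<N avoids)

runσ-below : ∀ {N L} → All (_< N) L → All (_< N) (outputσ L) × All (_< N) (stackσ L)
runσ-below {L = L} L<N = run-All ruleσ L [] (All.++⁺ L<N [])

sσ-around-max : ∀ {L N R} → All (_< N) L → All (_< N) R → sσ (L ++ N ∷ R) ≡ (outputσ L ++ s₁₂ R) ++ N ∷ stackσ L
sσ-around-max {L} {N} {R} L<N R<N = begin
  sσ (L ++ N ∷ R)                                                    ≡⟨ cong (λ r → proj₂ r ++ proj₁ r) (runσ-around-max L N R L<N R<N) ⟩
  (outputσ L ++ proj₂ (run rule₁₂ R [])) ++ proj₁ (run rule₁₂ R []) ++ N ∷ stackσ L
    ≡⟨ List.++-assoc (outputσ L) _ _ ⟩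
  outputσ L ++ proj₂ (run rule₁₂ R []) ++ proj₁ (run rule₁₂ R []) ++ N ∷ stackσ L
    ≡⟨ cong (outputσ L ++_) (List.++-assoc (proj₂ (run rule₁₂ R [])) _ _) ⟨
  outputσ L ++ s₁₂ R ++ N ∷ stackσ L                                 ≡⟨ List.++-assoc (outputσ L) (s₁₂ R) _ ⟨
  (outputσ L ++ s₁₂ R) ++ N ∷ stackσ L                               ∎
  where open ≡-Reasoning

-- Factors around the maximum

-- shift i L ++ (n+1) ∷ R is sorted by s₂₁ ∘ sσ exactly when R is a RightFactor i
-- and L a LeftFactor (n ∸ i).
record RightFactor (i : ℕ) (R : List ℕ) : Set where
  constructor rightFactor
  field s₁₂-decreasing : s₁₂ R ≡ reverse (interval 0 i)

record LeftFactor (k : ℕ) (L : List ℕ) : Set where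
  constructor leftFactor
  field
    silent : outputσ L ≡ []
    sorted : s₂₁ (stackσ L) ≡ interval 0 k

stackσ-↭ : ∀ L → outputσ L ≡ [] → stackσ L ↭ L
stackσ-↭ L silent = ↭-trans (↭-reflexive (cong (_++ stackσ L) (sym silent))) (stackSort-↭ ruleσ L)

RightFactor-↭ : ∀ {i R} → RightFactor i R → R ↭ interval 0 i
RightFactor-↭ {i} (rightFactor sorted) = ↭-trans (stackSort-≡⇒↭ rule₁₂ sorted) (↭.↭-reverse (interval 0 i))

LeftFactor-↭ : ∀ {k L} → LeftFactor k L → L ↭ interval 0 k
LeftFactor-↭ {L = L} (leftFactor silent sorted) = ↭-trans (↭-sym (stackσ-↭ L silent)) (stackSort-≡⇒↭ rule₂₁ sorted)

length-RightFactor : ∀ {i R} → RightFactor i R → length R ≡ i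
length-RightFactor {i} factor = trans (↭.↭-length (RightFactor-↭ factor)) (length-interval 0 i)

length-LeftFactor : ∀ {k L} → LeftFactor k L → length L ≡ k
length-LeftFactor {k} factor = trans (↭.↭-length (LeftFactor-↭ factor)) (length-interval 0 k)

RightFactor-irrelevant : ∀ {i R} (a b : RightFactor i R) → a ≡ b
RightFactor-irrelevant (rightFactor p) (rightFactor q) = cong rightFactor (List≡-irrelevant p q)

LeftFactor-irrelevant : ∀ {k L} (a b : LeftFactor k L) → a ≡ b
LeftFactor-irrelevant (leftFactor p₁ p₂) (leftFactor q₁ q₂) =
  cong₂ leftFactor (List≡-irrelevant p₁ q₁) (List≡-irrelevant p₂ q₂)

RightFactor-bound : ∀ {n i R} → i ≤ n → RightFactor i R → All (_< suc n) R
RightFactor-bound {i = i} i≤n factorR =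
  All.map (λ z≤i → s≤s (≤-trans z≤i i≤n)) (↭-interval-below 0 i (RightFactor-↭ factorR))

RightFactor-unshift : ∀ s i R⁺ → s₁₂ R⁺ ≡ reverse (interval s i) → ∃ λ R → R⁺ ≡ shift s R × RightFactor i R
RightFactor-unshift s i R⁺ sorted = R , sym R⁺≡ , rightFactor (shift-injective s (begin
  shift s (s₁₂ R)                 ≡⟨ s₁₂-shift s R ⟨
  s₁₂ (shift s R)                 ≡⟨ cong s₁₂ R⁺≡ ⟩
  s₁₂ R⁺                          ≡⟨ sorted ⟩
  reverse (interval s i)          ≡⟨ shift-reverse-interval s i ⟨
  shift s (reverse (interval 0 i)) ∎))
  where
  open ≡-Reasoning
  R = map (_∸ s) R⁺
  R⁺≡ : shift s R ≡ R⁺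
  R⁺≡ = shift-∸ s (All.map <⇒≤ (↭-interval-above s i
          (↭-trans (stackSort-≡⇒↭ rule₁₂ sorted) (↭.↭-reverse (interval s i)))))

LeftFactor-unshift : ∀ s k L⁺ → outputσ L⁺ ≡ [] → s₂₁ (stackσ L⁺) ≡ interval s k →
  ∃ λ L → L⁺ ≡ shift s L × LeftFactor k L
LeftFactor-unshift s k L⁺ silent sorted = L , sym L⁺≡ , leftFactor silent′ sorted′
  where
  open ≡-Reasoning
  L = map (_∸ s) L⁺
  L⁺≡ : shift s L ≡ L⁺
  L⁺≡ = shift-∸ s (All.map <⇒≤ (↭-interval-above s k
          (↭-trans (↭-sym (stackσ-↭ L⁺ silent)) (stackSort-≡⇒↭ rule₂₁ sorted))))
  run≡ : run ruleσ L⁺ [] ≡ shift² s (run ruleσ L [])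
  run≡ = trans (cong (λ xs → run ruleσ xs []) (sym L⁺≡)) (runσ-shift s L)
  silent′ : outputσ L ≡ []
  silent′ = shift-injective s (trans (sym (cong proj₂ run≡)) silent)
  sorted′ : s₂₁ (stackσ L) ≡ interval 0 k
  sorted′ = shift-injective s (begin
    shift s (s₂₁ (stackσ L))  ≡⟨ s₂₁-shift s (stackσ L) ⟨
    s₂₁ (shift s (stackσ L))  ≡⟨ cong (s₂₁ ∘ proj₁) run≡ ⟨
    s₂₁ (stackσ L⁺)           ≡⟨ sorted ⟩
    interval s k              ≡⟨ shift-interval s k ⟨
    shift s (interval 0 k)    ∎)

LeftFactor-sorted : ∀ {k L} → LeftFactor k L → s₂₁ (sσ L) ≡ interval 0 k
LeftFactor-sorted {L = L} (leftFactor silent sorted) = trans (cong (λ o → s₂₁ (o ++ stackσ L)) silent) sorted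

silent-sorted⇒LeftFactor : ∀ {k L} → outputσ L ≡ [] → s₂₁ (sσ L) ≡ interval 0 k → LeftFactor k L
silent-sorted⇒LeftFactor {L = L} silent sorted =
  leftFactor silent (trans (cong (λ o → s₂₁ (o ++ stackσ L)) (sym silent)) sorted)

interval-RightFactor : ∀ i → RightFactor i (interval 0 i)
interval-RightFactor i = rightFactor (cong (λ r → proj₂ r ++ proj₁ r) (run₁₂-interval 0 i [] []))

RightFactor-silent : ∀ {i R} → RightFactor i R → proj₂ (run rule₁₂ R []) ≡ [] → R ≡ interval 0 i
RightFactor-silent {i} {R} (rightFactor decreasing) silent = List.reverse-injective (begin
  reverse R                ≡⟨ run-silent rule₁₂ R [] silent ⟨
  proj₁ (run rule₁₂ R [])  ≡⟨ cong (_++ proj₁ (run rule₁₂ R [])) silent ⟨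
  s₁₂ R                    ≡⟨ decreasing ⟩
  reverse (interval 0 i)   ∎)
  where open ≡-Reasoning

insertMax : ℕ → List ℕ → List ℕ → List ℕ
insertMax N L R = shift (length R) L ++ N ∷ R

insertMax-bound : ∀ n (R : List ℕ) {i j L} → i + j ≤ n → length R ≡ i → LeftFactor j L →
  All (_< suc n) (shift (length R) L)
insertMax-bound n R {i} {j} i+j≤n refl factorL =
  All.map⁺ (All.map (λ z≤j → s≤s (≤-trans (+-monoʳ-≤ i z≤j) i+j≤n)) (↭-interval-below 0 j (LeftFactor-↭ factorL)))

insertMax-injective : ∀ {N L R L′ R′} → All (_< N) (shift (length R) L) → All (_< N) (shift (length R′) L′) →
  insertMax N L R ≡ insertMax N L′ R′ → L ≡ L′ × R ≡ R′
insertMax-injective {R = R} {L′} {R′} L<N L′<N eq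
  with ∷-split-injective (shift (length R) _) (shift (length R′) L′) (<-∉ L<N) (<-∉ L′<N) eq
... | L≡ , refl = shift-injective (length R) L≡ , refl

runσ-insertMax : ∀ {N L R} → outputσ L ≡ [] → All (_< N) (shift (length R) L) → All (_< N) R →
  run ruleσ (insertMax N L R) [] ≡ (proj₁ (run rule₁₂ R []) ++ N ∷ shift (length R) (stackσ L) , proj₂ (run rule₁₂ R []))
runσ-insertMax {N} {L} {R} silent L<N R<N
  rewrite runσ-around-max (shift (length R) L) N R L<N R<N | runσ-shift (length R) L | silent = refl

sσ-insertMax : ∀ {N L R} → outputσ L ≡ [] → All (_< N) (shift (length R) L) → All (_< N) R →
  sσ (insertMax N L R) ≡ s₁₂ R ++ N ∷ shift (length R) (stackσ L)
sσ-insertMax {N} {L} {R} silent L<N R<N =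
  trans (cong (λ r → proj₂ r ++ proj₁ r) (runσ-insertMax silent L<N R<N)) (sym (List.++-assoc (proj₂ (run rule₁₂ R [])) _ _))

interval-around : ∀ {i n} → i ≤ n → interval 0 i ++ interval i (n ∸ i) ++ [ suc n ] ≡ interval 0 (suc n)
interval-around {i} {n} i≤n = begin
  interval 0 i ++ interval i (n ∸ i) ++ [ suc n ]    ≡⟨ List.++-assoc (interval 0 i) _ _ ⟨
  (interval 0 i ++ interval i (n ∸ i)) ++ [ suc n ]  ≡⟨ cong (_++ [ suc n ]) (interval-++ 0 i (n ∸ i)) ⟨
  interval 0 (i + (n ∸ i)) ++ [ suc n ]              ≡⟨ cong (λ k → interval 0 k ++ [ suc n ]) (m+[n∸m]≡n i≤n) ⟩
  interval 0 n ++ [ suc n ]                          ≡⟨ interval-∷ʳ 0 n ⟨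
  interval 0 (suc n)                                 ∎
  where open ≡-Reasoning

insertMax-sorted : ∀ n {i L R} → i ≤ n → RightFactor i R → LeftFactor (n ∸ i) L →
  s₂₁ (sσ (insertMax (suc n) L R)) ≡ interval 0 (suc n)
insertMax-sorted n {i} {L} {R} i≤n factorR@(rightFactor decreasing) factorL@(leftFactor silent sorted) = begin
  s₂₁ (sσ (insertMax (suc n) L R))
    ≡⟨ cong s₂₁ (sσ-insertMax silent L<N R<N) ⟩
  s₂₁ (s₁₂ R ++ suc n ∷ shift (length R) (stackσ L))
    ≡⟨ s₂₁-around-max (s₁₂-All R<N) (↭.All-resp-↭ (↭.map⁺ (length R +_) (↭-sym (stackσ-↭ L silent))) L<N) ⟩
  s₂₁ (s₁₂ R) ++ s₂₁ (shift (length R) (stackσ L)) ++ [ suc n ]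
    ≡⟨ cong₂ (λ u v → u ++ v ++ [ suc n ]) (trans (cong s₂₁ decreasing) (s₂₁-reverse-interval 0 i))
             (trans (s₂₁-shift (length R) (stackσ L)) (cong (shift (length R)) sorted)) ⟩
  interval 0 i ++ shift (length R) (interval 0 (n ∸ i)) ++ [ suc n ]
    ≡⟨ cong (λ l → interval 0 i ++ shift l (interval 0 (n ∸ i)) ++ [ suc n ]) length≡ ⟩
  interval 0 i ++ shift i (interval 0 (n ∸ i)) ++ [ suc n ]
    ≡⟨ cong (λ I → interval 0 i ++ I ++ [ suc n ]) (shift-interval i (n ∸ i)) ⟩
  interval 0 i ++ interval i (n ∸ i) ++ [ suc n ]
    ≡⟨ interval-around i≤n ⟩
  interval 0 (suc n)
    ∎
  where
  open ≡-Reasoning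
  length≡ = length-RightFactor factorR
  L<N = insertMax-bound n R (≤-reflexive (m+[n∸m]≡n i≤n)) length≡ factorL
  R<N = RightFactor-bound i≤n factorR

sortable-split : ∀ n τ → s₂₁ (sσ τ) ≡ interval 0 (suc n) →
  ∃ λ i → i ≤ n × ∃₂ λ R L → RightFactor i R × LeftFactor (n ∸ i) L × τ ≡ insertMax (suc n) L R
sortable-split n τ sorted with split-at-max n (↭-trans (↭-sym (stackSort-↭ ruleσ τ)) (stackSort-≡⇒↭ rule₂₁ sorted))
... | L⁺ , R , refl , L⁺<N , R<N
  with s₂₁-sorted-around-max n (All.++⁺ (proj₁ (runσ-below L⁺<N)) (s₁₂-All R<N)) (proj₂ (runσ-below L⁺<N))
         (trans (cong s₂₁ (sym (sσ-around-max L⁺<N R<N))) sorted)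
... | i≤n , sorted-left , sorted-right = factors i≤n sorted-left sorted-right
  where
  factors : ∀ {i} → i ≤ n → s₂₁ (outputσ L⁺ ++ s₁₂ R) ≡ interval 0 i → s₂₁ (stackσ L⁺) ≡ interval i (n ∸ i) →
    ∃ λ i → i ≤ n × ∃₂ λ R′ L → RightFactor i R′ × LeftFactor (n ∸ i) L × L⁺ ++ suc n ∷ R ≡ insertMax (suc n) L R′
  factors {i} i≤n sorted-left sorted-right with outputσ-below-stack⇒[] L⁺ (s₂₁-sorted-separated sorted-left sorted-right)
  ... | silent with LeftFactor-unshift i (n ∸ i) L⁺ silent sorted-right
  ... | L , L⁺≡ , factorL = i , i≤n , R , L , factorR , factorL ,
    cong (_++ suc n ∷ R) (trans L⁺≡ (cong (λ l → shift l L) (sym (length-RightFactor factorR))))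
    where
    factorR : RightFactor i R
    factorR = rightFactor (s₂₁∘s₁₂-sorted⇒decreasing i R
                (subst (λ o → s₂₁ (o ++ s₁₂ R) ≡ interval 0 i) silent sorted-left))

-- Counting through decompositions

Σ< : ℕ → (ℕ → Set) → Set
Σ< m X = Σ ℕ λ i → i < m × X i

module Decomposition (n : ℕ) {Whole : List ℕ → Set} {First Second : ℕ → List ℕ → Set}
  (Whole-irrelevant  : ∀ {τ} (a b : Whole τ) → a ≡ b)
  (First-irrelevant  : ∀ {i A} (a b : First i A) → a ≡ b)
  (Second-irrelevant : ∀ {i B} (a b : Second i B) → a ≡ b)
  (length-First : ∀ {i A} → First i A → length A ≡ i)
  (join : List ℕ → List ℕ → List ℕ)
  (join-injective : ∀ {i A B i′ A′ B′} → i ≤ n → i′ ≤ n → First i A → Second (n ∸ i) B →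
                    First i′ A′ → Second (n ∸ i′) B′ → join A B ≡ join A′ B′ → A ≡ A′ × B ≡ B′)
  (join-Whole : ∀ {i A B} → i ≤ n → First i A → Second (n ∸ i) B → Whole (join A B))
  (split : ∀ τ → Whole τ → ∃ λ i → i ≤ n × ∃₂ λ A B → First i A × Second (n ∸ i) B × τ ≡ join A B)
  where

  Parts : Set
  Parts = Σ< (suc n) λ i → Σ (List ℕ) (First i) × Σ (List ℕ) (Second (n ∸ i))

  to : Σ (List ℕ) Whole → Parts
  to (τ , whole) with split τ whole
  ... | i , i≤n , A , B , first , second , _ = i , s≤s i≤n , (A , first) , (B , second)

  from : Parts → Σ (List ℕ) Whole
  from (i , s≤s i≤n , (A , first) , (B , second)) = join A B , join-Whole i≤n first second

  to∘from : ∀ p → to (from p) ≡ p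
  to∘from (i , s≤s i≤n , (A , first) , (B , second)) with split (join A B) (join-Whole i≤n first second)
  ... | i′ , i′≤n , A′ , B′ , first′ , second′ , eq with join-injective i′≤n i≤n first′ second′ first second (sym eq)
  ... | refl , refl with trans (sym (length-First first′)) (length-First first)
  ... | refl rewrite First-irrelevant first first′ | Second-irrelevant second second′ | ≤-irrelevant i≤n i′≤n = refl

  from∘to : ∀ t → from (to t) ≡ t
  from∘to (τ , whole) with split τ whole
  ... | i , i≤n , A , B , first , second , refl rewrite Whole-irrelevant (join-Whole i≤n first second) whole = refl

  ↔Parts : Σ (List ℕ) Whole ↔ Parts
  ↔Parts = mk↔ₛ′ to from to∘from from∘to

↔Fin-cast : ∀ {A : Set} {m n} → A ↔ Fin m → m ≡ n → A ↔ Fin n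
↔Fin-cast A↔Fin refl = A↔Fin

Σ<-cong : ∀ m {X Y : ℕ → Set} → (∀ i → i < m → X i ↔ Y i) → Σ< m X ↔ Σ< m Y
Σ<-cong m X↔Y = mk↔ₛ′
  (λ (i , i<m , x) → i , i<m , Inverse.to (X↔Y i i<m) x)
  (λ (i , i<m , y) → i , i<m , Inverse.from (X↔Y i i<m) y)
  (λ (i , i<m , y) → cong (λ y′ → i , i<m , y′) (Inverse.strictlyInverseˡ (X↔Y i i<m) y))
  (λ (i , i<m , x) → cong (λ x′ → i , i<m , x′) (Inverse.strictlyInverseʳ (X↔Y i i<m) x))

Σ<-suc : ∀ m {X : ℕ → Set} → Σ< (suc m) X ↔ (Σ< m X ⊎ X m)
Σ<-suc m {X} = mk↔ₛ′ to from to∘from from∘to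
  where
  to : Σ< (suc m) X → Σ< m X ⊎ X m
  to (i , s≤s i≤m , x) with m≤n⇒m<n∨m≡n i≤m
  ... | inj₁ i<m  = inj₁ (i , i<m , x)
  ... | inj₂ refl = inj₂ x
  from : Σ< m X ⊎ X m → Σ< (suc m) X
  from (inj₁ (i , i<m , x)) = i , m<n⇒m<1+n i<m , x
  from (inj₂ x)             = m , ≤-refl , x
  to∘from : ∀ y → to (from y) ≡ y
  to∘from (inj₁ (i , i<m , x)) with m<n⇒m<1+n i<m
  ... | s≤s i≤m with m≤n⇒m<n∨m≡n i≤m
  ...   | inj₁ i<m′ rewrite <-irrelevant i<m i<m′ = refl
  ...   | inj₂ refl = ⊥-elim (<-irrefl refl i<m)
  to∘from (inj₂ x) with m≤n⇒m<n∨m≡n (≤-refl {m})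
  ... | inj₁ m<m  = ⊥-elim (<-irrefl refl m<m)
  ... | inj₂ refl = refl
  from∘to : ∀ x → from (to x) ≡ x
  from∘to (i , s≤s i≤m , x) with m≤n⇒m<n∨m≡n i≤m
  ... | inj₁ i<m  rewrite ≤-irrelevant (m<n⇒m<1+n i<m) (s≤s i≤m) = refl
  ... | inj₂ refl rewrite ≤-irrelevant i≤m ≤-refl = refl

Σ<-Fin : ∀ m (f : ℕ → ℕ) → Σ< m (Fin ∘ f) ↔ Fin (sumBelow m f)
Σ<-Fin zero    f = mk↔ₛ′ (λ ()) (λ ()) (λ ()) (λ ())
Σ<-Fin (suc m) f = ↔-trans (Σ<-suc m) (↔-trans (Σ<-Fin m f ⊎-↔ ↔-refl) (↔-sym Fin.+↔⊎))

×-singleton↔ : ∀ {A : Set} (c : List ℕ) → (A × Σ (List ℕ) (_≡ c)) ↔ A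
×-singleton↔ c = mk↔ₛ′ proj₁ (λ a → a , c , refl) (λ _ → refl) (λ { (_ , _ , refl) → refl })

sumBelow-cong : ∀ m {f g : ℕ → ℕ} → (∀ i → i < m → f i ≡ g i) → sumBelow m f ≡ sumBelow m g
sumBelow-cong zero    _   = refl
sumBelow-cong (suc m) f≗g = cong₂ _+_ (sumBelow-cong m (λ i i<m → f≗g i (m<n⇒m<1+n i<m))) (f≗g m ≤-refl)

-- Right factors and binary trees

joinR : List ℕ → List ℕ → List ℕ
joinR Y X = shift (suc (length Y)) X ++ 1 ∷ shift 1 Y

RightFactor-shift-above-1 : ∀ s {i Z} → RightFactor i Z → All (1 <_) (shift (suc s) Z)
RightFactor-shift-above-1 s {i} factor =
  All.map⁺ (All.map (λ {z} 0<z → s≤s (≤-trans 0<z (m≤n+m z s))) (↭-interval-above 0 i (RightFactor-↭ factor)))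

s₁₂-shift-RightFactor : ∀ s {i Z} → RightFactor i Z → s₁₂ (shift s Z) ≡ reverse (interval s i)
s₁₂-shift-RightFactor s {i} {Z} (rightFactor factor) =
  trans (s₁₂-shift s Z) (trans (cong (shift s) factor) (shift-reverse-interval s i))

RightFactor-join : ∀ {m b Y X} → b ≤ m → RightFactor b Y → RightFactor (m ∸ b) X → RightFactor (suc m) (joinR Y X)
RightFactor-join {m} {b} {Y} {X} b≤m factorY factorX = rightFactor (begin
  s₁₂ (shift (suc (length Y)) X ++ 1 ∷ shift 1 Y)
    ≡⟨ cong (λ l → s₁₂ (shift (suc l) X ++ 1 ∷ shift 1 Y)) (length-RightFactor factorY) ⟩
  s₁₂ (shift (suc b) X ++ 1 ∷ shift 1 Y)
    ≡⟨ s₁₂-around-min (RightFactor-shift-above-1 b factorX) (RightFactor-shift-above-1 0 factorY) ⟩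
  s₁₂ (shift (suc b) X) ++ s₁₂ (shift 1 Y) ++ [ 1 ]
    ≡⟨ cong₂ (λ u v → u ++ v ++ [ 1 ]) (s₁₂-shift-RightFactor (suc b) factorX) (s₁₂-shift-RightFactor 1 factorY) ⟩
  reverse (interval (suc b) (m ∸ b)) ++ reverse (interval 1 b) ++ [ 1 ]
    ≡⟨ reverse-interval-split b (m ∸ b) ⟨
  reverse (interval 0 (suc (b + (m ∸ b))))
    ≡⟨ cong (λ k → reverse (interval 0 (suc k))) (m+[n∸m]≡n b≤m) ⟩
  reverse (interval 0 (suc m))
    ∎)
  where open ≡-Reasoning

RightFactor-around-1 : ∀ m {X Y} → All (1 <_) X → All (1 <_) Y → RightFactor (suc m) (X ++ 1 ∷ Y) →
  s₁₂ X ++ s₁₂ Y ≡ reverse (interval 1 m)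
RightFactor-around-1 m {X} {Y} X>1 Y>1 (rightFactor factor) = List.∷ʳ-injectiveˡ _ _ (begin
  (s₁₂ X ++ s₁₂ Y) ++ [ 1 ]        ≡⟨ List.++-assoc (s₁₂ X) (s₁₂ Y) [ 1 ] ⟩
  s₁₂ X ++ s₁₂ Y ++ [ 1 ]          ≡⟨ s₁₂-around-min X>1 Y>1 ⟨
  s₁₂ (X ++ 1 ∷ Y)                 ≡⟨ factor ⟩
  reverse (interval 0 (suc m))     ≡⟨ List.unfold-reverse 1 (interval 1 m) ⟩
  reverse (interval 1 m) ++ [ 1 ]  ∎)
  where open ≡-Reasoning

RightFactor-split : ∀ m R → RightFactor (suc m) R →
  ∃ λ b → b ≤ m × ∃₂ λ Y X → RightFactor b Y × RightFactor (m ∸ b) X × R ≡ joinR Y X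
RightFactor-split m R factor with split-at-1 m (RightFactor-↭ factor)
... | X⁺ , Y⁺ , refl , X⁺>1 , Y⁺>1
  with ++≡reverse-interval 1 m (s₁₂ X⁺) (s₁₂ Y⁺) (RightFactor-around-1 m X⁺>1 Y⁺>1 factor)
... | b≤m , Y⁺≡ , X⁺≡ = parts b≤m Y⁺≡ X⁺≡
  where
  parts : ∀ {b} → b ≤ m → s₁₂ Y⁺ ≡ reverse (interval 1 b) → s₁₂ X⁺ ≡ reverse (interval (suc b) (m ∸ b)) →
    ∃ λ b → b ≤ m × ∃₂ λ Y X → RightFactor b Y × RightFactor (m ∸ b) X × X⁺ ++ 1 ∷ Y⁺ ≡ joinR Y X
  parts {b} b≤m Y⁺≡ X⁺≡ with RightFactor-unshift 1 b Y⁺ Y⁺≡ | RightFactor-unshift (suc b) (m ∸ b) X⁺ X⁺≡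
  ... | Y , Y⁺≡1+Y , factorY | X , X⁺≡1+b+X , factorX =
    b , b≤m , Y , X , factorY , factorX ,
    cong₂ (λ u v → u ++ 1 ∷ v)
          (trans X⁺≡1+b+X (cong (λ l → shift (suc l) X) (sym (length-RightFactor factorY)))) Y⁺≡1+Y

joinR-injective : ∀ {a Y X a′ Y′ X′} → RightFactor a X → RightFactor a′ X′ →
  joinR Y X ≡ joinR Y′ X′ → Y ≡ Y′ × X ≡ X′
joinR-injective {Y = Y} {X} {Y′ = Y′} {X′} factorX factorX′ eq
  with ∷-split-injective (shift (suc (length Y)) X) (shift (suc (length Y′)) X′)
         (>-∉ (RightFactor-shift-above-1 (length Y) factorX)) (>-∉ (RightFactor-shift-above-1 (length Y′) factorX′)) eq
... | X≡ , Y≡ with shift-injective 1 Y≡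
... | refl = refl , shift-injective (suc (length Y)) X≡

-- Forest r m: preorder words of sequences of r binary trees with m internal nodes
-- in total; node joins the first two trees of the rest under a new root.
data Forest : ℕ → ℕ → Set where
  nil  : Forest 0 0
  leaf : ∀ {r m} → Forest r m → Forest (suc r) m
  node : ∀ {r m} → Forest (suc (suc r)) m → Forest (suc r) (suc m)

forestCount : ℕ → ℕ → ℕ
forestCount zero    zero    = 1
forestCount zero    (suc m) = 0
forestCount (suc r) zero    = forestCount r zero
forestCount (suc r) (suc m) = forestCount r (suc m) + forestCount (suc (suc r)) m

Forest↔Fin : ∀ r m → Forest r m ↔ Fin (forestCount r m)
Forest↔Fin zero    zero    =
  mk↔ₛ′ (λ _ → Fin.zero) (λ _ → nil) (λ { Fin.zero → refl ; (Fin.suc ()) }) (λ { nil → refl })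
Forest↔Fin zero    (suc m) = mk↔ₛ′ (λ ()) (λ ()) (λ ()) (λ ())
Forest↔Fin (suc r) zero    =
  ↔-trans (mk↔ₛ′ (λ { (leaf f) → f }) leaf (λ _ → refl) (λ { (leaf f) → refl })) (Forest↔Fin r zero)
Forest↔Fin (suc r) (suc m) =
  ↔-trans leaf-or-node (↔-trans (Forest↔Fin r (suc m) ⊎-↔ Forest↔Fin (suc (suc r)) m) (↔-sym Fin.+↔⊎))
  where
  leaf-or-node : Forest (suc r) (suc m) ↔ (Forest r (suc m) ⊎ Forest (suc (suc r)) m)
  leaf-or-node = mk↔ₛ′ (λ { (leaf f) → inj₁ f ; (node f) → inj₂ f }) (λ { (inj₁ f) → leaf f ; (inj₂ f) → node f })
    (λ { (inj₁ f) → refl ; (inj₂ f) → refl }) (λ { (leaf f) → refl ; (node f) → refl })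

splitForest : ∀ a {c m} → Forest (a + c) m → Σ< (suc m) (λ i → Forest a i × Forest c (m ∸ i))
splitForest zero    f        = 0 , s≤s z≤n , nil , f
splitForest (suc a) (leaf f) with splitForest a f
... | i , i<1+m , f₁ , f₂ = i , i<1+m , leaf f₁ , f₂
splitForest (suc a) (node f) with splitForest (suc (suc a)) f
... | i , s≤s i≤m , f₁ , f₂ = suc i , s≤s (s≤s i≤m) , node f₁ , f₂

joinForest : ∀ {a c m i} → i < suc m → Forest a i → Forest c (m ∸ i) → Forest (a + c) m
joinForest                i<1+m       nil       f₂ = f₂
joinForest                i<1+m       (leaf f₁) f₂ = leaf (joinForest i<1+m f₁ f₂)
joinForest {m = suc m} (s≤s i≤m) (node f₁) f₂ = node (joinForest i≤m f₁ f₂)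

splitForest-joinForest : ∀ {a c m i} (i<1+m : i < suc m) (f₁ : Forest a i) (f₂ : Forest c (m ∸ i)) →
  splitForest a (joinForest i<1+m f₁ f₂) ≡ (i , i<1+m , f₁ , f₂)
splitForest-joinForest (s≤s z≤n) nil f₂ = refl
splitForest-joinForest i<1+m (leaf f₁) f₂ rewrite splitForest-joinForest i<1+m f₁ f₂ = refl
splitForest-joinForest {m = suc m} (s≤s (s≤s i≤m)) (node f₁) f₂ rewrite splitForest-joinForest (s≤s i≤m) f₁ f₂ = refl

joinForest-splitForest : ∀ a {c m} (f : Forest (a + c) m) →
  let (i , i<1+m , f₁ , f₂) = splitForest a f in joinForest i<1+m f₁ f₂ ≡ f
joinForest-splitForest zero    f = refl
joinForest-splitForest (suc a) (leaf f) with splitForest a f | joinForest-splitForest a f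
... | i , i<1+m , f₁ , f₂ | eq = cong leaf eq
joinForest-splitForest (suc a) {m = suc m} (node f) with splitForest (suc (suc a)) f | joinForest-splitForest (suc (suc a)) f
... | i , s≤s i≤m , f₁ , f₂ | eq = cong node eq

Forest-++↔ : ∀ a c m → Forest (a + c) m ↔ Σ< (suc m) (λ i → Forest a i × Forest c (m ∸ i))
Forest-++↔ a c m = mk↔ₛ′ (splitForest a) (λ (i , i<1+m , f₁ , f₂) → joinForest i<1+m f₁ f₂)
  (λ (i , i<1+m , f₁ , f₂) → splitForest-joinForest i<1+m f₁ f₂) (joinForest-splitForest a)

Tree-suc↔ : ∀ m → Forest 1 (suc m) ↔ Σ< (suc m) (λ i → Forest 1 i × Forest 1 (m ∸ i))
Tree-suc↔ m = ↔-trans root (Forest-++↔ 1 1 m)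
  where
  root : Forest 1 (suc m) ↔ Forest 2 m
  root = mk↔ₛ′ (λ { (node f) → f ; (leaf ()) }) node (λ _ → refl) (λ { (node f) → refl ; (leaf ()) })

RightFactors : ℕ → Set
RightFactors i = Σ (List ℕ) (RightFactor i)

RightFactors-suc↔ : ∀ m → RightFactors (suc m) ↔ Σ< (suc m) (λ i → RightFactors i × RightFactors (m ∸ i))
RightFactors-suc↔ m = Decomposition.↔Parts m {RightFactor (suc m)} {RightFactor} {RightFactor}
  RightFactor-irrelevant RightFactor-irrelevant RightFactor-irrelevant length-RightFactor
  joinR (λ _ _ _ factorX _ → joinR-injective factorX) RightFactor-join (RightFactor-split m)

RightFactors-zero↔ : RightFactors 0 ↔ Forest 1 0
RightFactors-zero↔ = mk↔ₛ′ (λ _ → leaf nil) (λ _ → [] , rightFactor refl) (λ { (leaf nil) → refl }) empty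
  where
  empty : ∀ R → ([] , rightFactor refl) ≡ R
  empty (R , factor) with ↭.↭-empty-inv (RightFactor-↭ {0} {R} factor)
  ... | refl = cong ([] ,_) (RightFactor-irrelevant _ factor)

RightFactors↔Tree : ∀ m → RightFactors m ↔ Forest 1 m
RightFactors↔Tree = <-rec (λ m → RightFactors m ↔ Forest 1 m) step
  where
  step : ∀ m → (∀ {k} → k < m → RightFactors k ↔ Forest 1 k) → RightFactors m ↔ Forest 1 m
  step zero    _   = RightFactors-zero↔
  step (suc m) rec = ↔-trans (RightFactors-suc↔ m)
    (↔-trans (Σ<-cong (suc m) (λ i i<1+m → rec i<1+m ×-↔ rec (s≤s (m∸n≤m m i)))) (↔-sym (Tree-suc↔ m)))

-- Ballot and Catalan numbers

[k+1]*[n+1]C[k+1]≡[n+1]*nCk : ∀ n k → suc k * (suc n C suc k) ≡ suc n * (n C k)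
[k+1]*[n+1]C[k+1]≡[n+1]*nCk zero    zero    = refl
[k+1]*[n+1]C[k+1]≡[n+1]*nCk zero    (suc k) = *-zeroʳ (suc (suc k))
[k+1]*[n+1]C[k+1]≡[n+1]*nCk (suc n) zero    = trans (*-identityˡ _) (trans (nC1≡n (suc (suc n))) (sym (*-identityʳ _)))
[k+1]*[n+1]C[k+1]≡[n+1]*nCk (suc n) (suc k) = begin
  suc (suc k) * (suc (suc n) C suc (suc k))  ≡⟨ cong (suc (suc k) *_) (nCk+nC[k+1]≡[n+1]C[k+1] (suc n) (suc k)) ⟨
  suc (suc k) * (a + b)                      ≡⟨ *-distribˡ-+ (suc (suc k)) a b ⟩
  (a + suc k * a) + suc (suc k) * b
    ≡⟨ cong₂ (λ u v → (a + u) + v) ([k+1]*[n+1]C[k+1]≡[n+1]*nCk n k) ([k+1]*[n+1]C[k+1]≡[n+1]*nCk n (suc k)) ⟩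
  (a + suc n * c) + suc n * d                ≡⟨ +-assoc a _ _ ⟩
  a + (suc n * c + suc n * d)                ≡⟨ cong (a +_) (*-distribˡ-+ (suc n) c d) ⟨
  a + suc n * (c + d)                        ≡⟨ cong (λ z → a + suc n * z) (nCk+nC[k+1]≡[n+1]C[k+1] n k) ⟩
  a + suc n * a                              ∎
  where
  open ≡-Reasoning
  a = suc n C suc k
  b = suc n C suc (suc k)
  c = n C k
  d = n C suc k

[m+1]*[2m+2]C[m+1]≡[m+2]*[2m+2]Cm : ∀ m → suc m * (2 * suc m C suc m) ≡ suc (suc m) * (2 * suc m C m)
[m+1]*[2m+2]C[m+1]≡[m+2]*[2m+2]Cm m = +-cancelˡ-≡ (suc m * below) _ _ (begin
  suc m * below + suc m * central    ≡⟨ *-distribˡ-+ (suc m) below central ⟨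
  suc m * (below + central)          ≡⟨ cong (suc m *_) (nCk+nC[k+1]≡[n+1]C[k+1] N m) ⟩
  suc m * (suc N C suc m)            ≡⟨ [k+1]*[n+1]C[k+1]≡[n+1]*nCk N m ⟩
  suc N * below                      ≡⟨ cong (_* below) (solve 1 (λ m → con 1 :+ con 2 :* (con 1 :+ m) := (con 1 :+ m) :+ (con 2 :+ m))
                                                                 refl m) ⟩
  (suc m + suc (suc m)) * below      ≡⟨ *-distribʳ-+ below (suc m) (suc (suc m)) ⟩
  suc m * below + suc (suc m) * below ∎)
  where
  open ≡-Reasoning
  N       = 2 * suc m
  below   = N C m
  central = N C suc m

pascal-combine : ∀ N k {a b} → a + N C suc k ≡ N C suc (suc k) → b + N C k ≡ N C suc k →
  (a + b) + suc N C suc k ≡ suc N C suc (suc k)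
pascal-combine N k {a} {b} eqa eqb = begin
  (a + b) + suc N C suc k              ≡⟨ cong ((a + b) +_) (nCk+nC[k+1]≡[n+1]C[k+1] N k) ⟨
  (a + b) + (N C k + N C suc k)        ≡⟨ solve 4 (λ a b c d → (a :+ b) :+ (c :+ d) := (a :+ d) :+ (b :+ c))
                                                  refl a b (N C k) (N C suc k) ⟩
  (a + N C suc k) + (b + N C k)        ≡⟨ cong₂ _+_ eqa eqb ⟩
  N C suc (suc k) + N C suc k          ≡⟨ +-comm (N C suc (suc k)) (N C suc k) ⟩
  N C suc k + N C suc (suc k)          ≡⟨ nCk+nC[k+1]≡[n+1]C[k+1] N (suc k) ⟩
  suc N C suc (suc k)                  ∎
  where open ≡-Reasoning

forestCount-zero : ∀ r → forestCount r 0 ≡ 1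
forestCount-zero zero    = refl
forestCount-zero (suc r) = forestCount-zero r

ballot : ∀ m r → forestCount (suc r) (suc m) + (r + 2 * suc m) C m ≡ (r + 2 * suc m) C suc m
ballot zero    zero    = refl
ballot zero    (suc r) = begin
  (forestCount (suc r) 1 + forestCount (3 + r) 0) + 1
    ≡⟨ cong (λ z → (forestCount (suc r) 1 + z) + 1) (forestCount-zero (3 + r)) ⟩
  (forestCount (suc r) 1 + 1) + 1
    ≡⟨ cong (_+ 1) (trans (ballot zero r) (nC1≡n (r + 2))) ⟩
  (r + 2) + 1
    ≡⟨ +-comm (r + 2) 1 ⟩
  suc (r + 2)
    ≡⟨ nC1≡n (suc (r + 2)) ⟨
  suc (r + 2) C 1
    ∎
  where open ≡-Reasoning
ballot (suc m) zero    = subst (λ N → forestCount 1 (suc (suc m)) + N C suc m ≡ N C suc (suc m)) (sym N≡)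
  (pascal-combine N m (sym symmetric) (ballot m 1))
  where
  N = 1 + 2 * suc m
  N≡ : 2 * suc (suc m) ≡ suc N
  N≡ = solve 1 (λ m → con 2 :* (con 2 :+ m) := con 1 :+ (con 1 :+ con 2 :* (con 1 :+ m))) refl m
  N-split : N ≡ suc m + suc (suc m)
  N-split = solve 1 (λ m → con 1 :+ con 2 :* (con 1 :+ m) := (con 1 :+ m) :+ (con 2 :+ m)) refl m
  symmetric : N C suc (suc m) ≡ N C suc m
  symmetric = trans (nCk≡nC[n∸k] (subst (suc (suc m) ≤_) (sym N-split) (m≤n+m (suc (suc m)) (suc m))))
                    (cong (N C_) (trans (cong (_∸ suc (suc m)) N-split) (m+n∸n≡m (suc m) (suc (suc m)))))
ballot (suc m) (suc r) =
  pascal-combine N m (ballot (suc m) r)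
    (subst (λ N → forestCount (3 + r) (suc m) + N C m ≡ N C suc m) N≡ (ballot m (suc (suc r))))
  where
  N = r + 2 * suc (suc m)
  N≡ : suc (suc r) + 2 * suc m ≡ N
  N≡ = solve 2 (λ m r → (con 2 :+ r) :+ con 2 :* (con 1 :+ m) := r :+ con 2 :* (con 2 :+ m)) refl m r

catalan≡forestCount : ∀ m → catalan m ≡ forestCount 1 m
catalan≡forestCount zero    = refl
catalan≡forestCount (suc m) = trans (cong (_/ suc (suc m)) central≡) (m*n/n≡m trees (suc (suc m)))
  where
  trees   = forestCount 1 (suc m)
  below   = 2 * suc m C m
  central = 2 * suc m C suc m
  central≡ : central ≡ trees * suc (suc m)
  central≡ = trans (sym (+-cancelʳ-≡ (suc m * central) (suc (suc m) * trees) central (begin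
    suc (suc m) * trees + suc m * central   ≡⟨ cong (suc (suc m) * trees +_) ([m+1]*[2m+2]C[m+1]≡[m+2]*[2m+2]Cm m) ⟩
    suc (suc m) * trees + suc (suc m) * below ≡⟨ *-distribˡ-+ (suc (suc m)) trees below ⟨
    suc (suc m) * (trees + below)          ≡⟨ cong (suc (suc m) *_) (ballot m 0) ⟩
    central + suc m * central              ∎))) (*-comm (suc (suc m)) trees)
    where open ≡-Reasoning

RightFactors↔Fin : ∀ m → RightFactors m ↔ Fin (catalan m)
RightFactors↔Fin m = ↔Fin-cast (↔-trans (RightFactors↔Tree m) (Forest↔Fin 1 m)) (sym (catalan≡forestCount m))

-- Left factors

LeftFactor-join : ∀ {k j L I} → j ≤ k → LeftFactor j L → I ≡ interval 0 (k ∸ j) → LeftFactor (suc k) (insertMax (suc k) L I)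
LeftFactor-join {k} {j} {L} j≤k factorL refl = silent-sorted⇒LeftFactor silent
  (insertMax-sorted k (m∸n≤m k j) (interval-RightFactor (k ∸ j))
                    (subst (λ j′ → LeftFactor j′ L) (sym (m∸[m∸n]≡n j≤k)) factorL))
  where
  silent : outputσ (insertMax (suc k) L (interval 0 (k ∸ j))) ≡ []
  silent = trans (cong proj₂ (runσ-insertMax (LeftFactor.silent factorL)
                   (insertMax-bound k (interval 0 (k ∸ j)) (≤-reflexive (m∸n+n≡m j≤k)) (length-interval 0 (k ∸ j)) factorL)
                   (RightFactor-bound (m∸n≤m k j) (interval-RightFactor (k ∸ j)))))
                 (cong proj₂ (run₁₂-interval 0 (k ∸ j) [] []))

-- A left factor has no output, so neither has s₁₂ on the part after its maximum,
-- which forces that part to be increasing.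
LeftFactor-split : ∀ k L → LeftFactor (suc k) L →
  ∃ λ j → j ≤ k × ∃₂ λ L₀ I → LeftFactor j L₀ × I ≡ interval 0 (k ∸ j) × L ≡ insertMax (suc k) L₀ I
LeftFactor-split k L factor with sortable-split k L (LeftFactor-sorted factor)
... | i , i≤k , R , L₀ , factorR , factorL₀ , refl =
  k ∸ i , m∸n≤m k i , L₀ , R , factorL₀ , trans R≡ (cong (interval 0) (sym (m∸[m∸n]≡n i≤k))) , refl
  where
  R≡ : R ≡ interval 0 i
  R≡ = RightFactor-silent factorR (trans (sym (cong proj₂ (runσ-insertMax (LeftFactor.silent factorL₀)
         (insertMax-bound k R (≤-reflexive (m+[n∸m]≡n i≤k)) (length-RightFactor factorR) factorL₀)
         (RightFactor-bound i≤k factorR)))) (LeftFactor.silent factor))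

LeftFactors : ℕ → Set
LeftFactors k = Σ (List ℕ) (LeftFactor k)

LeftFactors-suc↔ : ∀ k → LeftFactors (suc k) ↔ Σ< (suc k) (λ j → LeftFactors j × Σ (List ℕ) (_≡ interval 0 (k ∸ j)))
LeftFactors-suc↔ k = Decomposition.↔Parts k {LeftFactor (suc k)} {LeftFactor} {λ i I → I ≡ interval 0 i}
  LeftFactor-irrelevant LeftFactor-irrelevant List≡-irrelevant length-LeftFactor (insertMax (suc k)) injective
  LeftFactor-join (LeftFactor-split k)
  where
  injective : ∀ {j L I j′ L′ I′} → j ≤ k → j′ ≤ k → LeftFactor j L → I ≡ interval 0 (k ∸ j) →
    LeftFactor j′ L′ → I′ ≡ interval 0 (k ∸ j′) → insertMax (suc k) L I ≡ insertMax (suc k) L′ I′ → L ≡ L′ × I ≡ I′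
  injective {j} {j′ = j′} j≤k j′≤k factorL refl factorL′ refl =
    insertMax-injective (insertMax-bound k (interval 0 (k ∸ j)) (≤-reflexive (m∸n+n≡m j≤k)) (length-interval 0 (k ∸ j)) factorL)
                        (insertMax-bound k (interval 0 (k ∸ j′)) (≤-reflexive (m∸n+n≡m j′≤k)) (length-interval 0 (k ∸ j′)) factorL′)

LeftFactors-zero↔ : LeftFactors 0 ↔ Fin 1
LeftFactors-zero↔ = mk↔ₛ′ (λ _ → Fin.zero) (λ _ → [] , leftFactor refl refl) (λ { Fin.zero → refl ; (Fin.suc ()) }) empty
  where
  empty : ∀ L → ([] , leftFactor refl refl) ≡ L
  empty (L , factor) with ↭.↭-empty-inv (LeftFactor-↭ {0} {L} factor)
  ... | refl = cong ([] ,_) (LeftFactor-irrelevant _ factor)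

leftFactorCount : ℕ → ℕ
leftFactorCount zero    = 1
leftFactorCount (suc k) = 2 ^ k

sum-leftFactorCount : ∀ k → sumBelow (suc k) leftFactorCount ≡ 2 ^ k
sum-leftFactorCount zero    = refl
sum-leftFactorCount (suc k) = trans (cong (_+ 2 ^ k) (sum-leftFactorCount k)) (cong (2 ^ k +_) (sym (+-identityʳ (2 ^ k))))

LeftFactors↔Fin : ∀ k → LeftFactors k ↔ Fin (leftFactorCount k)
LeftFactors↔Fin = <-rec (λ k → LeftFactors k ↔ Fin (leftFactorCount k)) step
  where
  step : ∀ k → (∀ {j} → j < k → LeftFactors j ↔ Fin (leftFactorCount j)) → LeftFactors k ↔ Fin (leftFactorCount k)
  step zero    _   = LeftFactors-zero↔
  step (suc k) rec = ↔-trans (LeftFactors-suc↔ k)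
    (↔-trans (Σ<-cong (suc k) (λ j j<1+k → ↔-trans (×-singleton↔ (interval 0 (k ∸ j))) (rec j<1+k)))
    (↔Fin-cast (Σ<-Fin (suc k) leftFactorCount) (sum-leftFactorCount k)))

-- Sortable permutations

Sortable : ℕ → List ℕ → Set
Sortable n τ = T (isPerm n τ) × westSort (s-12-3 τ) ≡ ascending n

Sortable-irrelevant : ∀ {n τ} (a b : Sortable n τ) → a ≡ b
Sortable-irrelevant (p₁ , p₂) (q₁ , q₂) = cong₂ _,_ (T-irrelevant p₁ q₁) (List≡-irrelevant p₂ q₂)

westSort∘s-12-3≡s₂₁∘sσ : ∀ τ → westSort (s-12-3 τ) ≡ s₂₁ (sσ τ)
westSort∘s-12-3≡s₂₁∘sσ τ = trans (westSort≡s₂₁ (s-12-3 τ)) (cong s₂₁ (s-12-3≡sσ τ))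

Sortable⇒sorted : ∀ {n τ} → Sortable n τ → s₂₁ (sσ τ) ≡ interval 0 n
Sortable⇒sorted {n} {τ} (_ , sorts) = trans (sym (westSort∘s-12-3≡s₂₁∘sσ τ)) (trans sorts (ascending≡interval n))

sorted⇒Sortable : ∀ {n τ} → s₂₁ (sσ τ) ≡ interval 0 n → Sortable n τ
sorted⇒Sortable {n} {τ} sorted =
  ↭-interval⇒isPerm n τ (↭-trans (↭-sym (stackSort-↭ ruleσ τ)) (stackSort-≡⇒↭ rule₂₁ sorted)) ,
  trans (westSort∘s-12-3≡s₂₁∘sσ τ) (trans sorted (sym (ascending≡interval n)))

Sort-suc↔ : ∀ n → Sort-12-3 (suc n) ↔ Σ< (suc n) (λ i → RightFactors i × LeftFactors (n ∸ i))
Sort-suc↔ n = Decomposition.↔Parts n {Sortable (suc n)} {RightFactor} {LeftFactor}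
  (λ {τ} → Sortable-irrelevant {suc n} {τ}) RightFactor-irrelevant LeftFactor-irrelevant length-RightFactor
  (λ R L → insertMax (suc n) L R) injective
  (λ {_} {R} {L} i≤n factorR factorL → sorted⇒Sortable {τ = insertMax (suc n) L R} (insertMax-sorted n i≤n factorR factorL))
  (λ τ sortable → sortable-split n τ (Sortable⇒sorted {τ = τ} sortable))
  where
  injective : ∀ {i R L i′ R′ L′} → i ≤ n → i′ ≤ n → RightFactor i R → LeftFactor (n ∸ i) L →
    RightFactor i′ R′ → LeftFactor (n ∸ i′) L′ → insertMax (suc n) L R ≡ insertMax (suc n) L′ R′ → R ≡ R′ × L ≡ L′
  injective {R = R} {R′ = R′} i≤n i′≤n factorR factorL factorR′ factorL′ eq
    with insertMax-injective (insertMax-bound n R (≤-reflexive (m+[n∸m]≡n i≤n)) (length-RightFactor factorR) factorL)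
                             (insertMax-bound n R′ (≤-reflexive (m+[n∸m]≡n i′≤n)) (length-RightFactor factorR′) factorL′) eq
  ... | L≡L′ , R≡R′ = R≡R′ , L≡L′

formula-suc : ∀ n → sumBelow (suc n) (λ i → catalan i * leftFactorCount (n ∸ i)) ≡ formula (suc n)
formula-suc n = trans (cong₂ _+_ (sumBelow-cong n term) last) (+-comm _ (catalan n))
  where
  last : catalan n * leftFactorCount (n ∸ n) ≡ catalan n
  last = trans (cong (λ k → catalan n * leftFactorCount k) (n∸n≡0 n)) (*-identityʳ (catalan n))
  term : ∀ i → i < n → catalan i * leftFactorCount (n ∸ i) ≡ 2 ^ (n ∸ 1 ∸ i) * catalan i
  term i i<n = trans (cong (λ k → catalan i * leftFactorCount k) (+-∸-assoc 1 i<n))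
                     (trans (cong (λ k → catalan i * 2 ^ k) (sym (∸-+-assoc n 1 i))) (*-comm (catalan i) _))

mainTheorem7 : (n : ℕ) → 1 ≤ n → Sort-12-3 n ↔ Fin (formula n)
mainTheorem7 (suc n) _ =
  ↔-trans (Sort-suc↔ n)
  (↔-trans (Σ<-cong (suc n) (λ i _ → ↔-trans (RightFactors↔Fin i ×-↔ LeftFactors↔Fin (n ∸ i)) (↔-sym Fin.*↔×)))
  (↔Fin-cast (Σ<-Fin (suc n) (λ i → catalan i * leftFactorCount (n ∸ i))) (formula-suc n)))
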